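{- Let $\Phi$ be a logic program, $A$ an atomic formula and $y$ a term variable not occurring in $A$. Then $\Phi\vdash\{A\}\leadsto^*\emptyset$ if and only if $F(\Phi)\vdash\{A[y]\}\leadsto^*\emptyset$.
   Context: Atomic formulas $P(t_1,\dots,t_n)$ over first-order terms; a logic program is a list of closed Horn formulas $\kappa:\forall\underline{x}.B_1,\dots,B_m\Rightarrow C$ ($m\ge0$) labelled by distinct constants $\kappa$. LP-Unif reduction on multisets of atomic formulas: $\Psi\vdash\{A_1,\dots,A_i,\dots,A_n\}\leadsto\{\gamma A_1,\dots,\gamma B_1,\dots,\gamma B_m,\dots,\gamma A_n\}$ whenever $\kappa:\forall\underline{x}.B_1,\dots,B_m\Rightarrow C\in\Psi$ (quantified variables renamed apart) and $\gamma$ is a most general unifier of $C$ and $A_i$; $\leadsto^*$ is its reflexive–transitive closure. For $A\equiv P(t_1,\dots,t_n)$ and a term $t'$ whose free variables are disjoint from those of the $t_i$, $A[t']$ denotes $P(t_1,\dots,t_n,t')$. The realizability transformation $F(\Phi)$ replaces each axiom $\kappa:\forall\underline{x}.A_1,\dots,A_m\Rightarrow B$ by $\kappa:\forall\underline{x}.\forall\underline{y}.A_1[y_1],\dots,A_m[y_m]\Rightarrow B[f_\kappa(y_1,\dots,y_m)]$, where $y_1,\dots,y_m$ are fresh distinct variables and $f_\kappa$ is a new function symbol of arity $m$ associated with $\kappa$. -}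

module Defs where

open import Data.Nat using (ℕ; zero; suc; _+_; _⊔_)
open import Data.List using (List; []; _∷_; _++_; map; length; upTo; zipWith; foldr; concatMap)
open import Data.List.Membership.Propositional using (_∈_; _∉_)
open import Data.Product using (Σ; ∃; _×_; _,_)
open import Data.Sum using (_⊎_; inj₁; inj₂)
open import Relation.Binary.PropositionalEquality using (_≡_)
open import Relation.Binary.Construct.Closure.ReflexiveTransitive using (Star)

-- First-order terms over function symbols `Fn`, variables ℕ.
-- Arities are not enforced: a function symbol is applied to a list.

data Term (Fn : Set) : Set where
  var : ℕ → Term Fn
  fn  : Fn → List (Term Fn) → Term Fn

Subst : Set → Set
Subst Fn = ℕ → Term Fn

mutual
  substT : {Fn : Set} → Subst Fn → Term Fn → Term Fn
  substT σ (var x)   = σ x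
  substT σ (fn f ts) = fn f (substTs σ ts)

  substTs : {Fn : Set} → Subst Fn → List (Term Fn) → List (Term Fn)
  substTs σ []       = []
  substTs σ (t ∷ ts) = substT σ t ∷ substTs σ ts

mutual
  varsT : {Fn : Set} → Term Fn → List ℕ
  varsT (var x)   = x ∷ []
  varsT (fn f ts) = varsTs ts

  varsTs : {Fn : Set} → List (Term Fn) → List ℕ
  varsTs []       = []
  varsTs (t ∷ ts) = varsT t ++ varsTs ts

mutual
  mapT : {Fn Gn : Set} → (Fn → Gn) → Term Fn → Term Gn
  mapT h (var x)   = var x
  mapT h (fn f ts) = fn (h f) (mapTs h ts)

  mapTs : {Fn Gn : Set} → (Fn → Gn) → List (Term Fn) → List (Term Gn)
  mapTs h []       = []
  mapTs h (t ∷ ts) = mapT h t ∷ mapTs h ts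

record Atom (Fn Pr : Set) : Set where
  constructor atom
  field
    pred : Pr
    args : List (Term Fn)
open Atom public

substA : {Fn Pr : Set} → Subst Fn → Atom Fn Pr → Atom Fn Pr
substA σ (atom P ts) = atom P (substTs σ ts)

varsA : {Fn Pr : Set} → Atom Fn Pr → List ℕ
varsA (atom P ts) = varsTs ts

mapA : {Fn Gn Pr : Set} → (Fn → Gn) → Atom Fn Pr → Atom Gn Pr
mapA h (atom P ts) = atom P (mapTs h ts)

_[_] : {Fn Pr : Set} → Atom Fn Pr → Term Fn → Atom Fn Pr
atom P ts [ t ] = atom P (ts ++ t ∷ [])

-- Horn clauses  κ : ∀x. B₁,…,Bₘ ⇒ C  (all variables universally quantified)

record Clause (Fn Pr K : Set) : Set where
  constructor clause
  field
    label : K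
    body  : List (Atom Fn Pr)
    head  : Atom Fn Pr
open Clause public

Program : Set → Set → Set → Set
Program Fn Pr K = List (Clause Fn Pr K)

varsC : {Fn Pr K : Set} → Clause Fn Pr K → List ℕ
varsC (clause κ bs c) = concatMap varsA bs ++ varsA c

renameC : {Fn Pr K : Set} → (ℕ → ℕ) → Clause Fn Pr K → Clause Fn Pr K
renameC ρ (clause κ bs c) =
  clause κ (map (substA (λ x → var (ρ x))) bs) (substA (λ x → var (ρ x)) c)

Unifier : {Fn Pr : Set} → Subst Fn → Atom Fn Pr → Atom Fn Pr → Set
Unifier σ A B = substA σ A ≡ substA σ B

MGU : {Fn Pr : Set} → Subst Fn → Atom Fn Pr → Atom Fn Pr → Set
MGU {Fn} γ A B =
  Unifier γ A B ×
  ((σ : Subst Fn) → Unifier σ A B →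
     Σ (Subst Fn) λ δ → ∀ x → σ x ≡ substT δ (γ x))

-- Goals (multisets of atoms, represented as lists; the selected atom
-- may be at any position) and LP-Unif reduction

Goal : Set → Set → Set
Goal Fn Pr = List (Atom Fn Pr)

substG : {Fn Pr : Set} → Subst Fn → Goal Fn Pr → Goal Fn Pr
substG σ = map (substA σ)

varsG : {Fn Pr : Set} → Goal Fn Pr → List ℕ
varsG = concatMap varsA

InjectiveFn : (ℕ → ℕ) → Set
InjectiveFn ρ = ∀ {a b} → ρ a ≡ ρ b → a ≡ b

data _⊢_↝_ {Fn Pr K : Set} (Φ : Program Fn Pr K) : Goal Fn Pr → Goal Fn Pr → Set where
  step : ∀ (L : Goal Fn Pr) (A : Atom Fn Pr) (R : Goal Fn Pr)
           (c : Clause Fn Pr K) → c ∈ Φ →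
           (ρ : ℕ → ℕ) → InjectiveFn ρ →
           (∀ v → v ∈ varsC (renameC ρ c) → v ∉ varsG (L ++ A ∷ R)) →
           (γ : Subst Fn) → MGU γ (head (renameC ρ c)) A →
           Φ ⊢ (L ++ A ∷ R) ↝
               (substG γ L ++ substG γ (body (renameC ρ c)) ++ substG γ R)

_⊢_↝*_ : {Fn Pr K : Set} → Program Fn Pr K → Goal Fn Pr → Goal Fn Pr → Set
Φ ⊢ G ↝* H = Star (Φ ⊢_↝_) G H

-- New function symbols f_κ are
-- `inj₂ κ`; the original symbols are embedded by `inj₁`.
-- Fresh variables y₁,…,yₘ are chosen as n, n+1, …, n+m-1 where
-- n exceeds every variable of the clause.

maxList : List ℕ → ℕ
maxList = foldr _⊔_ 0

embA : {Fn Pr K : Set} → Atom Fn Pr → Atom (Fn ⊎ K) Pr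
embA = mapA inj₁

Fclause : {Fn Pr K : Set} → Clause Fn Pr K → Clause (Fn ⊎ K) Pr K
Fclause {Fn} {Pr} {K} (clause κ bs c) =
  clause κ
    (zipWith (λ B j → embA B [ var (n + j) ]) bs (upTo m))
    (embA c [ fn (inj₂ κ) (map (λ j → var (n + j)) (upTo m)) ])
  where
    m = length bs
    n = suc (maxList (varsC (clause κ bs c)))

F : {Fn Pr K : Set} → Program Fn Pr K → Program (Fn ⊎ K) Pr K
F = map Fclause

-- F(Φ) runs in lockstep with Φ.  The goals of F(Φ) reachable from A[y] are tagged goals
-- X₁[t₁],…,Xₙ[tₙ] with distinct tag variables tᵢ outside the Xᵢ, standing for the Φ-goal
-- X₁,…,Xₙ.  A Φ-step with κ : B₁,…,Bₘ ⇒ C lifts to an F(Φ)-step with F(κ): unification binds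
-- the tag of the selected atom to f_κ(y₁,…,yₘ), and the fresh yⱼ become the tags of the new
-- atoms Bⱼ[yⱼ]; the needed mgu exists by Robinson's algorithm.  Conversely, erasing the symbols
-- f_κ turns an mgu of an F(Φ)-step into a unifier of the Φ-step that is most general away from
-- the selected tag.  Making it most general on all variables, as LP-Unif requires, needs spare
-- variables, so soundness is proved for every renaming of the goal with a decidable inverse.

module Submission where

open import Defs
open import Algebra.Properties.CommutativeSemigroup using (interchange)
open import Data.Empty using (⊥-elim)
open import Data.List using (List; []; _∷_; _++_; map; length; zip; zipWith; filter; concatMap; upTo)
open import Data.List.Membership.Propositional using (_∈_; _∉_; find; lose)
open import Data.List.Membership.Propositional.Properties
  using (∈-++⁺ˡ; ∈-++⁺ʳ; ∈-++⁻; ∈-map⁺; ∈-map⁻; ∈-concatMap⁺; ∈-concatMap⁻; ∈-filter⁺)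
open import Data.List.Properties
  using (map-++; map-∘; map-id; map-cong-local; ++-assoc; ++-identityʳ; concatMap-++; ∷-injective;
         ∷ʳ-injective; filter-notAll; length-map; length-upTo)
open import Data.List.Relation.Binary.Disjoint.Propositional using (Disjoint)
open import Data.List.Relation.Binary.Subset.Propositional using (_⊆_)
open import Data.List.Relation.Unary.All using (All; []; _∷_)
import Data.List.Relation.Unary.All as All
import Data.List.Relation.Unary.All.Properties as All
open import Data.List.Relation.Unary.AllPairs using ([]; _∷_)
open import Data.List.Relation.Unary.Any using (here; there)
import Data.List.Relation.Unary.Any as Any
open import Data.List.Relation.Unary.Unique.Propositional using (Unique)
open import Data.List.Relation.Unary.Unique.Propositional.Properties using (Unique[x∷xs]⇒x∉xs)
import Data.List.Relation.Unary.Unique.Propositional.Properties as Unique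
open import Data.Maybe using (Maybe; just; nothing)
open import Data.Nat using (ℕ; zero; suc; z≤n; s≤s; _+_; _∸_; _≤_; _<_; _≟_; _≤?_)
open import Data.List.Membership.DecPropositional _≟_ using (_∈?_)
open import Data.Nat.ListAction using (sum)
open import Data.Nat.ListAction.Properties using (sum-++)
open import Data.Nat.Properties
  using (≤-refl; ≤-trans; ≤-pred; n≤1+n; <-irrefl; ≤⇒≯; m≤m+n; m≤n+m; m≤m⊔n; m≤n⊔m;
         +-comm; +-suc; +-monoˡ-≤; +-monoʳ-≤; +-cancelˡ-≡; +-commutativeSemigroup;
         suc-injective; m+n∸m≡n; module ≤-Reasoning)
open import Data.Product using (∃-syntax; Σ-syntax; _×_; _,_; proj₁; proj₂)
import Data.Product as Product
open import Data.Sum using (_⊎_; inj₁; inj₂; [_,_]′)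
import Data.Sum as Sum
open import Function using (case_of_; const)
open import Function.Bundles using (_⇔_; mk⇔)
open import Relation.Binary.Construct.Closure.ReflexiveTransitive using (ε; _◅_)
open import Relation.Binary.PropositionalEquality
  using (_≡_; _≢_; refl; sym; trans; cong; cong₂; subst; module ≡-Reasoning)
open import Relation.Nullary using (yes; no; ¬?)

variable
  Fn Gn Pr K : Set

-- Substitutions

infixr 9 _∘ₛ_

_∘ₛ_ : Subst Fn → Subst Fn → Subst Fn
(δ ∘ₛ σ) x = substT δ (σ x)

ren : (ℕ → ℕ) → Subst Fn
ren ρ x = var (ρ x)

fn-injective : {f g : Fn} {ts us : List (Term Fn)} → fn f ts ≡ fn g us → f ≡ g × ts ≡ us
fn-injective refl = refl , refl

mutual
  substT-cong : {σ τ : Subst Fn} (t : Term Fn) →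
                (∀ x → x ∈ varsT t → σ x ≡ τ x) → substT σ t ≡ substT τ t
  substT-cong (var x)   eq = eq x (here refl)
  substT-cong (fn f ts) eq = cong (fn f) (substTs-cong ts eq)

  substTs-cong : {σ τ : Subst Fn} (ts : List (Term Fn)) →
                 (∀ x → x ∈ varsTs ts → σ x ≡ τ x) → substTs σ ts ≡ substTs τ ts
  substTs-cong []       eq = refl
  substTs-cong (t ∷ ts) eq =
    cong₂ _∷_ (substT-cong t (λ x x∈ → eq x (∈-++⁺ˡ x∈)))
              (substTs-cong ts (λ x x∈ → eq x (∈-++⁺ʳ (varsT t) x∈)))

mutual
  substT-∘ : (δ σ : Subst Fn) (t : Term Fn) → substT δ (substT σ t) ≡ substT (δ ∘ₛ σ) t
  substT-∘ δ σ (var x)   = refl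
  substT-∘ δ σ (fn f ts) = cong (fn f) (substTs-∘ δ σ ts)

  substTs-∘ : (δ σ : Subst Fn) (ts : List (Term Fn)) →
              substTs δ (substTs σ ts) ≡ substTs (δ ∘ₛ σ) ts
  substTs-∘ δ σ []       = refl
  substTs-∘ δ σ (t ∷ ts) = cong₂ _∷_ (substT-∘ δ σ t) (substTs-∘ δ σ ts)

mutual
  substT-var : (t : Term Fn) → substT var t ≡ t
  substT-var (var x)   = refl
  substT-var (fn f ts) = cong (fn f) (substTs-var ts)

  substTs-var : (ts : List (Term Fn)) → substTs var ts ≡ ts
  substTs-var []       = refl
  substTs-var (t ∷ ts) = cong₂ _∷_ (substT-var t) (substTs-var ts)

mutual
  varsT-substT⁻ : (σ : Subst Fn) (t : Term Fn) {x : ℕ} → x ∈ varsT (substT σ t) →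
                  ∃[ y ] y ∈ varsT t × x ∈ varsT (σ y)
  varsT-substT⁻ σ (var y)   x∈ = y , here refl , x∈
  varsT-substT⁻ σ (fn f ts) x∈ = varsTs-substTs⁻ σ ts x∈

  varsTs-substTs⁻ : (σ : Subst Fn) (ts : List (Term Fn)) {x : ℕ} → x ∈ varsTs (substTs σ ts) →
                    ∃[ y ] y ∈ varsTs ts × x ∈ varsT (σ y)
  varsTs-substTs⁻ σ (t ∷ ts) x∈ with ∈-++⁻ (varsT (substT σ t)) x∈
  ... | inj₁ x∈t  = let y , y∈ , x∈σy = varsT-substT⁻ σ t x∈t in y , ∈-++⁺ˡ y∈ , x∈σy
  ... | inj₂ x∈ts = let y , y∈ , x∈σy = varsTs-substTs⁻ σ ts x∈ts in y , ∈-++⁺ʳ (varsT t) y∈ , x∈σy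

mutual
  varsT-substT⁺ : (σ : Subst Fn) (t : Term Fn) {x y : ℕ} →
                  y ∈ varsT t → x ∈ varsT (σ y) → x ∈ varsT (substT σ t)
  varsT-substT⁺ σ (var y)   (here refl) x∈ = x∈
  varsT-substT⁺ σ (fn f ts) y∈          x∈ = varsTs-substTs⁺ σ ts y∈ x∈

  varsTs-substTs⁺ : (σ : Subst Fn) (ts : List (Term Fn)) {x y : ℕ} →
                    y ∈ varsTs ts → x ∈ varsT (σ y) → x ∈ varsTs (substTs σ ts)
  varsTs-substTs⁺ σ (t ∷ ts) y∈ x∈ with ∈-++⁻ (varsT t) y∈
  ... | inj₁ y∈t  = ∈-++⁺ˡ (varsT-substT⁺ σ t y∈t x∈)
  ... | inj₂ y∈ts = ∈-++⁺ʳ (varsT (substT σ t)) (varsTs-substTs⁺ σ ts y∈ts x∈)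

varsTs-++ : (ts us : List (Term Fn)) → varsTs (ts ++ us) ≡ varsTs ts ++ varsTs us
varsTs-++ []       us = refl
varsTs-++ (t ∷ ts) us =
  trans (cong (varsT t ++_) (varsTs-++ ts us)) (sym (++-assoc (varsT t) (varsTs ts) (varsTs us)))

substTs-++ : (σ : Subst Fn) (ts us : List (Term Fn)) →
             substTs σ (ts ++ us) ≡ substTs σ ts ++ substTs σ us
substTs-++ σ []       us = refl
substTs-++ σ (t ∷ ts) us = cong (substT σ t ∷_) (substTs-++ σ ts us)

substTs-map-var : (σ : Subst Fn) (f : ℕ → ℕ) (js : List ℕ) →
                  substTs σ (map (λ j → var (f j)) js) ≡ map (λ j → σ (f j)) js
substTs-map-var σ f []       = refl
substTs-map-var σ f (j ∷ js) = cong (σ (f j) ∷_) (substTs-map-var σ f js)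

varsTs-map-var : (xs : List ℕ) → varsTs {Fn} (map var xs) ≡ xs
varsTs-map-var []       = refl
varsTs-map-var (x ∷ xs) = cong (x ∷_) (varsTs-map-var xs)

substA-cong : {σ τ : Subst Fn} (A : Atom Fn Pr) →
              (∀ x → x ∈ varsA A → σ x ≡ τ x) → substA σ A ≡ substA τ A
substA-cong (atom P ts) eq = cong (atom P) (substTs-cong ts eq)

substA-∘ : (δ σ : Subst Fn) (A : Atom Fn Pr) → substA δ (substA σ A) ≡ substA (δ ∘ₛ σ) A
substA-∘ δ σ (atom P ts) = cong (atom P) (substTs-∘ δ σ ts)

substA-var : (A : Atom Fn Pr) → substA var A ≡ A
substA-var (atom P ts) = cong (atom P) (substTs-var ts)

varsA-substA⁻ : (σ : Subst Fn) (A : Atom Fn Pr) {x : ℕ} → x ∈ varsA (substA σ A) →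
                ∃[ y ] y ∈ varsA A × x ∈ varsT (σ y)
varsA-substA⁻ σ (atom P ts) = varsTs-substTs⁻ σ ts

varsA-substA⁺ : (σ : Subst Fn) (A : Atom Fn Pr) {x y : ℕ} →
                y ∈ varsA A → x ∈ varsT (σ y) → x ∈ varsA (substA σ A)
varsA-substA⁺ σ (atom P ts) = varsTs-substTs⁺ σ ts

substA-[] : (σ : Subst Fn) (A : Atom Fn Pr) (u : Term Fn) →
            substA σ (A [ u ]) ≡ substA σ A [ substT σ u ]
substA-[] σ (atom P ts) u = cong (atom P) (substTs-++ σ ts (u ∷ []))

varsA-[] : (A : Atom Fn Pr) (u : Term Fn) → varsA (A [ u ]) ≡ varsA A ++ varsT u
varsA-[] (atom P ts) u =
  trans (varsTs-++ ts (u ∷ [])) (cong (varsTs ts ++_) (++-identityʳ (varsT u)))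

[]-injective : (A B : Atom Fn Pr) (u w : Term Fn) → A [ u ] ≡ B [ w ] → A ≡ B × u ≡ w
[]-injective (atom P ts) (atom Q us) u w eq with cong pred eq | ∷ʳ-injective ts us (cong args eq)
... | refl | ts≡us , u≡w = cong (atom P) ts≡us , u≡w

substG-cong : {σ τ : Subst Fn} (Gs : Goal Fn Pr) →
              (∀ x → x ∈ varsG Gs → σ x ≡ τ x) → substG σ Gs ≡ substG τ Gs
substG-cong []       eq = refl
substG-cong (A ∷ Gs) eq =
  cong₂ _∷_ (substA-cong A (λ x x∈ → eq x (∈-++⁺ˡ x∈)))
            (substG-cong Gs (λ x x∈ → eq x (∈-++⁺ʳ (varsA A) x∈)))

substG-∘ : (δ σ : Subst Fn) (Gs : Goal Fn Pr) → substG δ (substG σ Gs) ≡ substG (δ ∘ₛ σ) Gs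
substG-∘ δ σ []       = refl
substG-∘ δ σ (A ∷ Gs) = cong₂ _∷_ (substA-∘ δ σ A) (substG-∘ δ σ Gs)

substG-++ : (σ : Subst Fn) (Gs Hs : Goal Fn Pr) → substG σ (Gs ++ Hs) ≡ substG σ Gs ++ substG σ Hs
substG-++ σ = map-++ (substA σ)

substG-++₃ : (σ : Subst Fn) (Gs Hs Is : Goal Fn Pr) →
             substG σ (Gs ++ Hs ++ Is) ≡ substG σ Gs ++ substG σ Hs ++ substG σ Is
substG-++₃ σ Gs Hs Is = trans (substG-++ σ Gs (Hs ++ Is)) (cong (substG σ Gs ++_) (substG-++ σ Hs Is))

varsG-++ : (Gs Hs : Goal Fn Pr) → varsG (Gs ++ Hs) ≡ varsG Gs ++ varsG Hs
varsG-++ = concatMap-++ varsA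

varsG⁺ : {Gs : Goal Fn Pr} {A : Atom Fn Pr} {x : ℕ} → A ∈ Gs → x ∈ varsA A → x ∈ varsG Gs
varsG⁺ A∈ x∈ = ∈-concatMap⁺ varsA (lose A∈ x∈)

varsG⁻ : (Gs : Goal Fn Pr) {x : ℕ} → x ∈ varsG Gs → ∃[ A ] A ∈ Gs × x ∈ varsA A
varsG⁻ Gs x∈ = find (∈-concatMap⁻ varsA x∈)

varsG-substG⁻ : (σ : Subst Fn) (Gs : Goal Fn Pr) {x : ℕ} → x ∈ varsG (substG σ Gs) →
                ∃[ y ] y ∈ varsG Gs × x ∈ varsT (σ y)
varsG-substG⁻ σ Gs x∈ with varsG⁻ (substG σ Gs) x∈
... | _ , σA∈ , x∈σA with ∈-map⁻ (substA σ) σA∈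
...   | A , A∈ , refl = let y , y∈ , x∈σy = varsA-substA⁻ σ A x∈σA in y , varsG⁺ A∈ y∈ , x∈σy

varsA-ren⁻ : (ρ : ℕ → ℕ) (A : Atom Fn Pr) {v : ℕ} → v ∈ varsA (substA (ren ρ) A) →
             ∃[ a ] a ∈ varsA A × v ≡ ρ a
varsA-ren⁻ ρ A v∈ with varsA-substA⁻ (ren ρ) A v∈
... | a , a∈ , here refl = a , a∈ , refl

varsG-ren⁻ : (ρ : ℕ → ℕ) (Gs : Goal Fn Pr) {v : ℕ} → v ∈ varsG (substG (ren ρ) Gs) →
             ∃[ a ] a ∈ varsG Gs × v ≡ ρ a
varsG-ren⁻ ρ Gs v∈ with varsG-substG⁻ (ren ρ) Gs v∈
... | a , a∈ , here refl = a , a∈ , refl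

varsC-renameC⁻ : (ρ : ℕ → ℕ) (c : Clause Fn Pr K) {v : ℕ} → v ∈ varsC (renameC ρ c) →
                 ∃[ a ] a ∈ varsC c × v ≡ ρ a
varsC-renameC⁻ ρ (clause κ bs C) v∈ with ∈-++⁻ (varsG (map (substA (ren ρ)) bs)) v∈
... | inj₁ v∈bs = let a , a∈ , eq = varsG-ren⁻ ρ bs v∈bs in a , ∈-++⁺ˡ a∈ , eq
... | inj₂ v∈C  = let a , a∈ , eq = varsA-ren⁻ ρ C v∈C in a , ∈-++⁺ʳ (varsG bs) a∈ , eq

-- Unification

Equation : Set → Set
Equation Fn = Term Fn × Term Fn

Solves : Subst Fn → List (Equation Fn) → Set
Solves σ = All (λ e → substT σ (proj₁ e) ≡ substT σ (proj₂ e))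

MostGeneral : Subst Fn → List (Equation Fn) → Set
MostGeneral {Fn} μ E = Solves μ E × ((σ : Subst Fn) → Solves σ E → ∀ x → σ x ≡ substT σ (μ x))

mutual
  size : Term Fn → ℕ
  size (var x)   = 1
  size (fn f ts) = suc (sizes ts)

  sizes : List (Term Fn) → ℕ
  sizes []       = 0
  sizes (t ∷ ts) = size t + sizes ts

sizeE : List (Equation Fn) → ℕ
sizeE E = sum (map (λ e → size (proj₁ e) + size (proj₂ e)) E)

varsE : List (Equation Fn) → List ℕ
varsE = concatMap (λ e → varsT (proj₁ e) ++ varsT (proj₂ e))

substE : Subst Fn → List (Equation Fn) → List (Equation Fn)
substE σ = map (Product.map (substT σ) (substT σ))

mutual
  size-varsT : (σ : Subst Fn) (t : Term Fn) {x : ℕ} → x ∈ varsT t → size (σ x) ≤ size (substT σ t)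
  size-varsT σ (var y)   (here refl) = ≤-refl
  size-varsT σ (fn f ts) x∈          = ≤-trans (size-varsTs σ ts x∈) (n≤1+n _)

  size-varsTs : (σ : Subst Fn) (ts : List (Term Fn)) {x : ℕ} → x ∈ varsTs ts →
                size (σ x) ≤ sizes (substTs σ ts)
  size-varsTs σ (t ∷ ts) x∈ with ∈-++⁻ (varsT t) x∈
  ... | inj₁ x∈t  = ≤-trans (size-varsT σ t x∈t) (m≤m+n _ _)
  ... | inj₂ x∈ts = ≤-trans (size-varsTs σ ts x∈ts) (m≤n+m _ _)

occurs-check : (σ : Subst Fn) (f : Fn) (ts : List (Term Fn)) {x : ℕ} →
               x ∈ varsTs ts → σ x ≢ substT σ (fn f ts)
occurs-check σ f ts x∈ eq =
  <-irrefl refl (subst (λ u → size u ≤ sizes (substTs σ ts)) eq (size-varsTs σ ts x∈))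

_↦_ : ℕ → Term Fn → Subst Fn
(x ↦ t) v with v ≟ x
... | yes _ = t
... | no  _ = var v

↦-self : (x : ℕ) (t : Term Fn) → (x ↦ t) x ≡ t
↦-self x t with x ≟ x
... | yes _  = refl
... | no x≢x = ⊥-elim (x≢x refl)

↦-fresh : (x : ℕ) (t : Term Fn) → x ∉ varsT t → substT (x ↦ t) t ≡ t
↦-fresh x t x∉t = trans (substT-cong t bound-only-x) (substT-var t)
  where
    bound-only-x : ∀ v → v ∈ varsT t → (x ↦ t) v ≡ var v
    bound-only-x v v∈ with v ≟ x
    ... | yes refl = ⊥-elim (x∉t v∈)
    ... | no  _    = refl

↦-absorbed : (σ : Subst Fn) (x : ℕ) (t : Term Fn) → σ x ≡ substT σ t →
             ∀ v → substT σ ((x ↦ t) v) ≡ σ v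
↦-absorbed σ x t σx≡σt v with v ≟ x
... | yes refl = sym σx≡σt
... | no  _    = refl

↦-vars : (x : ℕ) (t : Term Fn) {v w : ℕ} → w ∈ varsT ((x ↦ t) v) →
         (v ≡ x × w ∈ varsT t) ⊎ (v ≢ x × w ≡ v)
↦-vars x t {v} w∈ with v ≟ x
... | yes v≡x = inj₁ (v≡x , w∈)
... | no  v≢x with w∈
...   | here w≡v = inj₂ (v≢x , w≡v)

solves-substE⁻ : (μ s : Subst Fn) (E : List (Equation Fn)) → Solves μ (substE s E) → Solves (μ ∘ₛ s) E
solves-substE⁻ μ s []      []         = []
solves-substE⁻ μ s (e ∷ E) (eq ∷ sol) =
  trans (sym (substT-∘ μ s (proj₁ e))) (trans eq (substT-∘ μ s (proj₂ e))) ∷ solves-substE⁻ μ s E sol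

solves-substE-↦ : (σ : Subst Fn) (x : ℕ) (t : Term Fn) → σ x ≡ substT σ t →
                  (E : List (Equation Fn)) → Solves σ E → Solves σ (substE (x ↦ t) E)
solves-substE-↦ σ x t σx≡σt []      []         = []
solves-substE-↦ σ x t σx≡σt (e ∷ E) (eq ∷ sol) =
  trans (absorbed (proj₁ e)) (trans eq (sym (absorbed (proj₂ e)))) ∷ solves-substE-↦ σ x t σx≡σt E sol
  where
    absorbed : ∀ a → substT σ (substT (x ↦ t) a) ≡ substT σ a
    absorbed a = trans (substT-∘ σ (x ↦ t) a) (substT-cong a (λ v _ → ↦-absorbed σ x t σx≡σt v))

solves-zip⁺ : (σ : Subst Fn) (ts us : List (Term Fn)) →
              substTs σ ts ≡ substTs σ us → Solves σ (zip ts us)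
solves-zip⁺ σ []       []       eq = []
solves-zip⁺ σ []       (u ∷ us) ()
solves-zip⁺ σ (t ∷ ts) []       ()
solves-zip⁺ σ (t ∷ ts) (u ∷ us) eq =
  let eqt , eqs = ∷-injective eq in eqt ∷ solves-zip⁺ σ ts us eqs

solves-zip⁻ : (σ : Subst Fn) (ts us : List (Term Fn)) → length ts ≡ length us →
              Solves σ (zip ts us) → substTs σ ts ≡ substTs σ us
solves-zip⁻ σ []       []       _   []         = refl
solves-zip⁻ σ (t ∷ ts) (u ∷ us) len (eq ∷ sol) =
  cong₂ _∷_ eq (solves-zip⁻ σ ts us (suc-injective len) sol)

length-substTs : (σ : Subst Fn) (ts : List (Term Fn)) → length (substTs σ ts) ≡ length ts
length-substTs σ []       = refl
length-substTs σ (t ∷ ts) = cong suc (length-substTs σ ts)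

length-unified : (σ : Subst Fn) (ts us : List (Term Fn)) →
                 substTs σ ts ≡ substTs σ us → length ts ≡ length us
length-unified σ ts us eq = trans (sym (length-substTs σ ts)) (trans (cong length eq) (length-substTs σ us))

sizeE-zip : (ts us : List (Term Fn)) → sizeE (zip ts us) ≤ sizes ts + sizes us
sizeE-zip []       us       = z≤n
sizeE-zip (t ∷ ts) []       = z≤n
sizeE-zip (t ∷ ts) (u ∷ us) = begin
  size t + size u + sizeE (zip ts us)   ≤⟨ +-monoʳ-≤ (size t + size u) (sizeE-zip ts us) ⟩
  size t + size u + (sizes ts + sizes us) ≡⟨ interchange +-commutativeSemigroup (size t) (size u) _ _ ⟩
  size t + sizes ts + (size u + sizes us) ∎
  where open ≤-Reasoning

sizeE-++ : (E F : List (Equation Fn)) → sizeE (E ++ F) ≡ sizeE E + sizeE F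
sizeE-++ E F = trans (cong sum (map-++ _ E F)) (sum-++ (map _ E) (map _ F))

varsE-zip : (ts us : List (Term Fn)) → varsE (zip ts us) ⊆ varsTs ts ++ varsTs us
varsE-zip (t ∷ ts) (u ∷ us) v∈ with ∈-++⁻ (varsT t ++ varsT u) v∈
... | inj₂ v∈zip with ∈-++⁻ (varsTs ts) (varsE-zip ts us v∈zip)
...   | inj₁ v∈ts = ∈-++⁺ˡ (∈-++⁺ʳ (varsT t) v∈ts)
...   | inj₂ v∈us = ∈-++⁺ʳ (varsTs (t ∷ ts)) (∈-++⁺ʳ (varsT u) v∈us)
varsE-zip (t ∷ ts) (u ∷ us) v∈ | inj₁ v∈tu with ∈-++⁻ (varsT t) v∈tu
...   | inj₁ v∈t = ∈-++⁺ˡ (∈-++⁺ˡ v∈t)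
...   | inj₂ v∈u = ∈-++⁺ʳ (varsTs (t ∷ ts)) (∈-++⁺ˡ v∈u)

varsE⁺ : {E : List (Equation Fn)} {e : Equation Fn} {v : ℕ} →
         e ∈ E → v ∈ varsT (proj₁ e) ++ varsT (proj₂ e) → v ∈ varsE E
varsE⁺ e∈ v∈ = ∈-concatMap⁺ (λ e → varsT (proj₁ e) ++ varsT (proj₂ e)) (lose e∈ v∈)

varsE-substE⁻ : (σ : Subst Fn) (E : List (Equation Fn)) {w : ℕ} → w ∈ varsE (substE σ E) →
                ∃[ v ] v ∈ varsE E × w ∈ varsT (σ v)
varsE-substE⁻ σ E w∈
  with find (∈-concatMap⁻ (λ e → varsT (proj₁ e) ++ varsT (proj₂ e)) {xs = substE σ E} w∈)
... | _ , σe∈ , w∈σe with ∈-map⁻ (Product.map (substT σ) (substT σ)) σe∈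
...   | (a , b) , e∈ , refl with ∈-++⁻ (varsT (substT σ a)) w∈σe
...     | inj₁ w∈σa = let v , v∈ , w∈σv = varsT-substT⁻ σ a w∈σa
                      in v , varsE⁺ e∈ (∈-++⁺ˡ v∈) , w∈σv
...     | inj₂ w∈σb = let v , v∈ , w∈σv = varsT-substT⁻ σ b w∈σb
                      in v , varsE⁺ e∈ (∈-++⁺ʳ (varsT a) v∈) , w∈σv

without : ℕ → List ℕ → List ℕ
without x = filter (λ v → ¬? (v ≟ x))

length-without : (x : ℕ) (Vs : List ℕ) → x ∈ Vs → length (without x Vs) < length Vs
length-without x Vs x∈ =
  filter-notAll (λ v → ¬? (v ≟ x)) Vs (Any.map (λ x≡v v≢x → v≢x (sym x≡v)) x∈)

varsE-substE-↦ : (x : ℕ) (t : Term Fn) (Vs : List ℕ) → x ∉ varsT t → varsT t ⊆ Vs →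
                 (E : List (Equation Fn)) → varsE E ⊆ Vs → varsE (substE (x ↦ t) E) ⊆ without x Vs
varsE-substE-↦ x t Vs x∉t t⊆Vs E E⊆Vs w∈ with varsE-substE⁻ (x ↦ t) E w∈
... | v , v∈ , w∈xt with ↦-vars x t {v} w∈xt
...   | inj₁ (_ , w∈t)    =
  ∈-filter⁺ (λ v → ¬? (v ≟ x)) (t⊆Vs w∈t) (λ w≡x → x∉t (subst (_∈ varsT t) w≡x w∈t))
...   | inj₂ (v≢x , refl) = ∈-filter⁺ (λ v → ¬? (v ≟ x)) (E⊆Vs v∈) v≢x

varsE-swap : (a b : Term Fn) (E : List (Equation Fn)) → varsE ((a , b) ∷ E) ⊆ varsE ((b , a) ∷ E)
varsE-swap a b E v∈ with ∈-++⁻ (varsT a ++ varsT b) v∈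
... | inj₂ v∈E = ∈-++⁺ʳ (varsT b ++ varsT a) v∈E
... | inj₁ v∈ab with ∈-++⁻ (varsT a) v∈ab
...   | inj₁ v∈a = ∈-++⁺ˡ (∈-++⁺ʳ (varsT b) v∈a)
...   | inj₂ v∈b = ∈-++⁺ˡ (∈-++⁺ˡ v∈b)

mostGeneral-swap : {μ : Subst Fn} {a b : Term Fn} {E : List (Equation Fn)} →
                   MostGeneral μ ((b , a) ∷ E) → MostGeneral μ ((a , b) ∷ E)
mostGeneral-swap ((eq ∷ sol) , general) =
  (sym eq ∷ sol) , λ { σ (eqσ ∷ solσ) → general σ (sym eqσ ∷ solσ) }

mostGeneral-decompose : {μ : Subst Fn} (f : Fn) (ts us : List (Term Fn)) {E : List (Equation Fn)} →
                        length ts ≡ length us → MostGeneral μ (zip ts us ++ E) →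
                        MostGeneral μ ((fn f ts , fn f us) ∷ E)
mostGeneral-decompose {μ = μ} f ts us len (sol , general) =
  (cong (fn f) (solves-zip⁻ μ ts us len (All.++⁻ˡ (zip ts us) sol)) ∷ All.++⁻ʳ (zip ts us) sol) ,
  λ { σ (eqσ ∷ solσ) → general σ (All.++⁺ (solves-zip⁺ σ ts us (proj₂ (fn-injective eqσ))) solσ) }

mostGeneral-eliminate : {μ : Subst Fn} (x : ℕ) (t : Term Fn) (E : List (Equation Fn)) → x ∉ varsT t →
                        MostGeneral μ (substE (x ↦ t) E) → MostGeneral (μ ∘ₛ (x ↦ t)) ((var x , t) ∷ E)
mostGeneral-eliminate {μ = μ} x t E x∉t (sol , general) =
  (solves-x ∷ solves-substE⁻ μ (x ↦ t) E sol) , general-x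
  where
    open ≡-Reasoning
    solves-x : substT μ ((x ↦ t) x) ≡ substT (μ ∘ₛ (x ↦ t)) t
    solves-x = begin
      substT μ ((x ↦ t) x)         ≡⟨ cong (substT μ) (↦-self x t) ⟩
      substT μ t                    ≡⟨ cong (substT μ) (sym (↦-fresh x t x∉t)) ⟩
      substT μ (substT (x ↦ t) t)   ≡⟨ substT-∘ μ (x ↦ t) t ⟩
      substT (μ ∘ₛ (x ↦ t)) t       ∎
    general-x : ∀ σ → Solves σ ((var x , t) ∷ E) → ∀ v → σ v ≡ substT σ ((μ ∘ₛ (x ↦ t)) v)
    general-x σ (eqσ ∷ solσ) v = sym (begin
      substT σ (substT μ ((x ↦ t) v))   ≡⟨ substT-∘ σ μ ((x ↦ t) v) ⟩
      substT (σ ∘ₛ μ) ((x ↦ t) v)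
        ≡⟨ substT-cong ((x ↦ t) v) (λ w _ → sym (general σ (solves-substE-↦ σ x t eqσ E solσ) w)) ⟩
      substT σ ((x ↦ t) v)              ≡⟨ ↦-absorbed σ x t eqσ v ⟩
      σ v                               ∎)

sizeE-decompose : (ts us : List (Term Fn)) (E : List (Equation Fn)) {s : ℕ} →
                  sizes ts + suc (sizes us) + sizeE E ≤ s → sizeE (zip ts us ++ E) ≤ s
sizeE-decompose ts us E {s} size≤ = begin
  sizeE (zip ts us ++ E)                ≡⟨ sizeE-++ (zip ts us) E ⟩
  sizeE (zip ts us) + sizeE E            ≤⟨ +-monoˡ-≤ (sizeE E) (sizeE-zip ts us) ⟩
  sizes ts + sizes us + sizeE E          ≤⟨ +-monoˡ-≤ (sizeE E) (+-monoʳ-≤ (sizes ts) (n≤1+n _)) ⟩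
  sizes ts + suc (sizes us) + sizeE E    ≤⟨ size≤ ⟩
  s                                      ∎
  where open ≤-Reasoning

varsE-decompose : (f g : Fn) (ts us : List (Term Fn)) (E : List (Equation Fn)) →
                  varsE (zip ts us ++ E) ⊆ varsE ((fn f ts , fn g us) ∷ E)
varsE-decompose f g ts us E v∈
  with ∈-++⁻ (varsE (zip ts us)) (subst (_ ∈_) (concatMap-++ _ (zip ts us) E) v∈)
... | inj₁ v∈zip = ∈-++⁺ˡ (varsE-zip ts us v∈zip)
... | inj₂ v∈E   = ∈-++⁺ʳ (varsTs ts ++ varsTs us) v∈E

-- Robinson's algorithm, terminating lexicographically on the number of variables and the
-- size of the equations; the known solution θ makes clashes and occurs-check failures absurd.

mutual
  mgu-bounded : (k s : ℕ) (Vs : List ℕ) (E : List (Equation Fn)) → length Vs ≤ k → sizeE E ≤ s →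
                varsE E ⊆ Vs → (θ : Subst Fn) → Solves θ E → ∃[ μ ] MostGeneral μ E
  mgu-bounded k s Vs [] _ _ _ θ _ = var , [] , λ σ _ x → refl
  mgu-bounded k s Vs ((var x , t) ∷ E) len≤ size≤ ⊆Vs θ (eq ∷ sol) =
    eliminate k s Vs x t E len≤ size≤ ⊆Vs θ eq sol
  mgu-bounded k s Vs ((fn f ts , var x) ∷ E) len≤ size≤ ⊆Vs θ (eq ∷ sol) =
    let μ , mg = eliminate k s Vs x (fn f ts) E len≤ size≤′ ⊆Vs′ θ (sym eq) sol
    in μ , mostGeneral-swap mg
    where
      size≤′ : sizeE ((var x , fn f ts) ∷ E) ≤ s
      size≤′ = subst (λ n → n + sizeE E ≤ s) (+-comm (size (fn f ts)) 1) size≤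
      ⊆Vs′ : varsE ((var x , fn f ts) ∷ E) ⊆ Vs
      ⊆Vs′ v∈ = ⊆Vs (varsE-swap (var x) (fn f ts) E v∈)
  mgu-bounded k (suc s) Vs ((fn f ts , fn g us) ∷ E) len≤ (s≤s size≤) ⊆Vs θ (eq ∷ sol)
    with refl , θts≡θus ← fn-injective eq =
    let μ , mg = mgu-bounded k s Vs (zip ts us ++ E) len≤ (sizeE-decompose ts us E size≤)
                   (λ v∈ → ⊆Vs (varsE-decompose f f ts us E v∈))
                   θ (All.++⁺ (solves-zip⁺ θ ts us θts≡θus) sol)
    in μ , mostGeneral-decompose f ts us (length-unified θ ts us θts≡θus) mg

  eliminate : (k s : ℕ) (Vs : List ℕ) (x : ℕ) (t : Term Fn) (E : List (Equation Fn)) →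
              length Vs ≤ k → sizeE ((var x , t) ∷ E) ≤ s → varsE ((var x , t) ∷ E) ⊆ Vs →
              (θ : Subst Fn) → θ x ≡ substT θ t → Solves θ E → ∃[ μ ] MostGeneral μ ((var x , t) ∷ E)
  eliminate k s Vs x t E len≤ size≤ ⊆Vs θ eq sol with x ∈? varsT t
  eliminate k (suc s) Vs x (var .x) E len≤ (s≤s size≤) ⊆Vs θ eq sol | yes (here refl) =
    let μ , solμ , general = mgu-bounded k s Vs E len≤ (≤-trans (n≤1+n _) size≤)
                               (λ v∈ → ⊆Vs (there (there v∈))) θ sol
    in μ , (refl ∷ solμ) , λ { σ (_ ∷ solσ) → general σ solσ }
  eliminate k s Vs x (fn f ts) E len≤ size≤ ⊆Vs θ eq sol | yes x∈ = ⊥-elim (occurs-check θ f ts x∈ eq)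
  eliminate zero s Vs x t E len≤ size≤ ⊆Vs θ eq sol | no x∉t
    with () ← ≤-trans (length-without x Vs (⊆Vs (here refl))) len≤
  eliminate (suc k) s Vs x t E len≤ size≤ ⊆Vs θ eq sol | no x∉t =
    let μ , mg = mgu-bounded k (sizeE (substE (x ↦ t) E)) (without x Vs) (substE (x ↦ t) E)
                   (≤-pred (≤-trans (length-without x Vs (⊆Vs (here refl))) len≤)) ≤-refl
                   (varsE-substE-↦ x t Vs x∉t (λ v∈ → ⊆Vs (there (∈-++⁺ˡ v∈)))
                                   E (λ v∈ → ⊆Vs (there (∈-++⁺ʳ (varsT t) v∈))))
                   θ (solves-substE-↦ θ x t eq E sol)
    in μ ∘ₛ (x ↦ t) , mostGeneral-eliminate x t E x∉t mg

solvable⇒mgu : (θ : Subst Fn) (E : List (Equation Fn)) → Solves θ E → ∃[ μ ] MostGeneral μ E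
solvable⇒mgu θ E = mgu-bounded (length (varsE E)) (sizeE E) (varsE E) E ≤-refl ≤-refl (λ v∈ → v∈) θ

atom-injective : {P Q : Pr} {ts us : List (Term Fn)} → atom P ts ≡ atom Q us → P ≡ Q × ts ≡ us
atom-injective refl = refl , refl

unifiable⇒mgu : {θ : Subst Fn} (A B : Atom Fn Pr) → Unifier θ A B → ∃[ γ ] MGU γ A B
unifiable⇒mgu {θ = θ} (atom P ts) (atom Q us) θA≡θB with refl , θts≡θus ← atom-injective θA≡θB =
  let μ , sol , general = solvable⇒mgu θ (zip ts us) (solves-zip⁺ θ ts us θts≡θus)
  in μ , cong (atom P) (solves-zip⁻ μ ts us (length-unified θ ts us θts≡θus) sol) ,
     λ σ σA≡σB → σ , general σ (solves-zip⁺ σ ts us (proj₂ (atom-injective σA≡σB)))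

map-proj₁-zip : {A B : Set} (xs : List A) (ys : List B) → length xs ≡ length ys →
                map proj₁ (zip xs ys) ≡ xs
map-proj₁-zip []       []       _   = refl
map-proj₁-zip (x ∷ xs) (y ∷ ys) len = cong (x ∷_) (map-proj₁-zip xs ys (suc-injective len))

map-proj₂-zip : {A B : Set} (xs : List A) (ys : List B) → length xs ≡ length ys →
                map proj₂ (zip xs ys) ≡ ys
map-proj₂-zip []       []       _   = refl
map-proj₂-zip (x ∷ xs) (y ∷ ys) len = cong (y ∷_) (map-proj₂-zip xs ys (suc-injective len))

≤-maxList : {x : ℕ} (xs : List ℕ) → x ∈ xs → x ≤ maxList xs
≤-maxList (y ∷ xs) (here refl) = m≤m⊔n y (maxList xs)
≤-maxList (y ∷ xs) (there x∈)  = ≤-trans (≤-maxList xs x∈) (m≤n⊔m y (maxList xs))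

map-split : {A B : Set} (f : A → B) (xs : List A) (L : List B) (b : B) (R : List B) →
            map f xs ≡ L ++ b ∷ R →
            Σ[ xsL ∈ List A ] Σ[ a ∈ A ] Σ[ xsR ∈ List A ]
              xs ≡ xsL ++ a ∷ xsR × map f xsL ≡ L × f a ≡ b × map f xsR ≡ R
map-split f []       []      b R ()
map-split f []       (_ ∷ _) b R ()
map-split f (a ∷ xs) []      b R eq =
  let fa≡b , eqR = ∷-injective eq in [] , a , xs , refl , refl , fa≡b , eqR
map-split f (a ∷ xs) (l ∷ L) b R eq =
  let fa≡l , eq′ = ∷-injective eq
      xsL , a′ , xsR , xs≡ , eqL , eqb , eqR = map-split f xs L b R eq′
  in a ∷ xsL , a′ , xsR , cong (a ∷_) xs≡ , cong₂ _∷_ fa≡l eqL , eqb , eqR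

Unique-remove : {A : Set} (xs : List A) {z : A} {ys : List A} →
                Unique (xs ++ z ∷ ys) → z ∉ xs ++ ys × Unique (xs ++ ys)
Unique-remove []       (z≢ys ∷ !ys)  = Unique[x∷xs]⇒x∉xs (z≢ys ∷ !ys) , !ys
Unique-remove (x ∷ xs) (x≢ ∷ !rest) with All.++⁻ xs x≢
... | x≢xs , (x≢z ∷ x≢ys) =
  let z∉ , !xsys = Unique-remove xs !rest
  in (λ { (here z≡x) → x≢z (sym z≡x) ; (there z∈) → z∉ z∈ }) , All.++⁺ x≢xs x≢ys ∷ !xsys

Unique-insert : {A : Set} (xs zs ys : List A) → Unique (xs ++ ys) → Unique zs →
                Disjoint zs (xs ++ ys) → Unique (xs ++ zs ++ ys)
Unique-insert []       zs ys !ys          !zs zs#ys = Unique.++⁺ !zs !ys zs#ys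
Unique-insert (x ∷ xs) zs ys (x≢ ∷ !rest) !zs zs#xys =
  All.++⁺ x≢xs (All.++⁺ (All.tabulate x≢zs) x≢ys) ∷
  Unique-insert xs zs ys !rest !zs (λ (w∈zs , w∈) → zs#xys (w∈zs , there w∈))
  where
    x≢xs = proj₁ (All.++⁻ xs x≢)
    x≢ys = proj₂ (All.++⁻ xs x≢)
    x≢zs : ∀ {w} → w ∈ zs → x ≢ w
    x≢zs w∈zs refl = zs#xys (w∈zs , here refl)

mutual
  mapT-substT : (h : Fn → Gn) (s : Subst Fn) (t : Term Fn) →
                substT (λ x → mapT h (s x)) (mapT h t) ≡ mapT h (substT s t)
  mapT-substT h s (var x)   = refl
  mapT-substT h s (fn f ts) = cong (fn (h f)) (mapTs-substTs h s ts)

  mapTs-substTs : (h : Fn → Gn) (s : Subst Fn) (ts : List (Term Fn)) →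
                  substTs (λ x → mapT h (s x)) (mapTs h ts) ≡ mapTs h (substTs s ts)
  mapTs-substTs h s []       = refl
  mapTs-substTs h s (t ∷ ts) = cong₂ _∷_ (mapT-substT h s t) (mapTs-substTs h s ts)

mutual
  varsT-mapT : (h : Fn → Gn) (t : Term Fn) → varsT (mapT h t) ≡ varsT t
  varsT-mapT h (var x)   = refl
  varsT-mapT h (fn f ts) = varsTs-mapTs h ts

  varsTs-mapTs : (h : Fn → Gn) (ts : List (Term Fn)) → varsTs (mapTs h ts) ≡ varsTs ts
  varsTs-mapTs h []       = refl
  varsTs-mapTs h (t ∷ ts) = cong₂ _++_ (varsT-mapT h t) (varsTs-mapTs h ts)

mapA-substA : (h : Fn → Gn) (s : Subst Fn) (A : Atom Fn Pr) →
              substA (λ x → mapT h (s x)) (mapA h A) ≡ mapA h (substA s A)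
mapA-substA h s (atom P ts) = cong (atom P) (mapTs-substTs h s ts)

varsA-mapA : (h : Fn → Gn) (A : Atom Fn Pr) → varsA (mapA h A) ≡ varsA A
varsA-mapA h (atom P ts) = varsTs-mapTs h ts

embT : Term Fn → Term (Fn ⊎ K)
embT = mapT inj₁

-- The junk value var 0 for the new symbols f_κ is never observed: eraseT is only
-- applied to terms shown to lie in the image of embT.

mutual
  eraseT : Term (Fn ⊎ K) → Term Fn
  eraseT (var x)          = var x
  eraseT (fn (inj₁ f) ts) = fn f (eraseTs ts)
  eraseT (fn (inj₂ κ) ts) = var 0

  eraseTs : List (Term (Fn ⊎ K)) → List (Term Fn)
  eraseTs []       = []
  eraseTs (t ∷ ts) = eraseT t ∷ eraseTs ts

eraseA : Atom (Fn ⊎ K) Pr → Atom Fn Pr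
eraseA (atom P ts) = atom P (eraseTs ts)

mutual
  eraseT-embT : (t : Term Fn) → eraseT (embT {K = K} t) ≡ t
  eraseT-embT (var x)   = refl
  eraseT-embT (fn f ts) = cong (fn f) (eraseTs-embTs ts)

  eraseTs-embTs : (ts : List (Term Fn)) → eraseTs (mapTs (inj₁ {B = K}) ts) ≡ ts
  eraseTs-embTs []       = refl
  eraseTs-embTs (t ∷ ts) = cong₂ _∷_ (eraseT-embT t) (eraseTs-embTs ts)

mutual
  eraseT-substT-embT : (δ : Subst (Fn ⊎ K)) (t : Term Fn) →
                       eraseT (substT δ (embT t)) ≡ substT (λ x → eraseT (δ x)) t
  eraseT-substT-embT δ (var x)   = refl
  eraseT-substT-embT δ (fn f ts) = cong (fn f) (eraseTs-substTs-embTs δ ts)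

  eraseTs-substTs-embTs : (δ : Subst (Fn ⊎ K)) (ts : List (Term Fn)) →
                          eraseTs (substTs δ (mapTs inj₁ ts)) ≡ substTs (λ x → eraseT (δ x)) ts
  eraseTs-substTs-embTs δ []       = refl
  eraseTs-substTs-embTs δ (t ∷ ts) = cong₂ _∷_ (eraseT-substT-embT δ t) (eraseTs-substTs-embTs δ ts)

eraseA-substA-embA : (δ : Subst (Fn ⊎ K)) (A : Atom Fn Pr) →
                     eraseA (substA δ (embA A)) ≡ substA (λ x → eraseT (δ x)) A
eraseA-substA-embA δ (atom P ts) = cong (atom P) (eraseTs-substTs-embTs δ ts)

mutual
  substT≡embT⇒embT : (δ : Subst (Fn ⊎ K)) (u : Term (Fn ⊎ K)) {w : Term Fn} →
                     substT δ u ≡ embT w → u ≡ embT (eraseT u)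
  substT≡embT⇒embT δ (var x)          eq = refl
  substT≡embT⇒embT δ (fn (inj₁ f) us) {fn g ws} eq =
    cong (fn (inj₁ f)) (substTs≡embTs⇒embTs δ us (proj₂ (fn-injective eq)))
  substT≡embT⇒embT δ (fn (inj₁ f) us) {var _} ()
  substT≡embT⇒embT δ (fn (inj₂ κ) us) {fn _ _} ()
  substT≡embT⇒embT δ (fn (inj₂ κ) us) {var _} ()

  substTs≡embTs⇒embTs : (δ : Subst (Fn ⊎ K)) (us : List (Term (Fn ⊎ K))) {ws : List (Term Fn)} →
                        substTs δ us ≡ mapTs inj₁ ws → us ≡ mapTs inj₁ (eraseTs us)
  substTs≡embTs⇒embTs δ []       eq = refl
  substTs≡embTs⇒embTs δ (u ∷ us) {w ∷ ws} eq =
    let eq-u , eq-us = ∷-injective eq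
    in cong₂ _∷_ (substT≡embT⇒embT δ u eq-u) (substTs≡embTs⇒embTs δ us eq-us)

varOf : Term Fn → ℕ
varOf (var x)  = x
varOf (fn _ _) = 0

substT≡var⇒var : (δ : Subst Fn) (u : Term Fn) {w : ℕ} → substT δ u ≡ var w → u ≡ var (varOf u)
substT≡var⇒var δ (var x) eq = refl

-- Tagged goals

-- The tagged atom (X , t) stands for the atom X[t] of a goal of F(Φ).

Tagged : Set → Set → Set
Tagged Fn Pr = List (Atom Fn Pr × ℕ)

tagAtom : Atom Fn Pr × ℕ → Atom (Fn ⊎ K) Pr
tagAtom (X , t) = embA X [ var t ]

tagGoal : Tagged Fn Pr → Goal (Fn ⊎ K) Pr
tagGoal {K = K} = map (tagAtom {K = K})

atoms : Tagged Fn Pr → Goal Fn Pr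
atoms = map proj₁

tags : Tagged Fn Pr → List ℕ
tags = map proj₂

WellTagged : Tagged Fn Pr → Set
WellTagged T = Unique (tags T) × Disjoint (tags T) (varsG (atoms T))

varsA-tagAtom : (X : Atom Fn Pr) (t : ℕ) → varsA (tagAtom {K = K} (X , t)) ≡ varsA X ++ t ∷ []
varsA-tagAtom X t = trans (varsA-[] (embA X) (var t)) (cong (_++ t ∷ []) (varsA-mapA inj₁ X))

varsG-tagGoal⁺ : {T : Tagged Fn Pr} {X : Atom Fn Pr} {t x : ℕ} →
                 (X , t) ∈ T → x ∈ varsA X ++ t ∷ [] → x ∈ varsG (tagGoal {K = K} T)
varsG-tagGoal⁺ {X = X} {t} p∈ x∈ = varsG⁺ (∈-map⁺ tagAtom p∈) (subst (_ ∈_) (sym (varsA-tagAtom X t)) x∈)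

varsG-atoms⊆ : (T : Tagged Fn Pr) → varsG (atoms T) ⊆ varsG (tagGoal {K = K} T)
varsG-atoms⊆ T x∈ with varsG⁻ (atoms T) x∈
... | _ , X∈ , x∈X with ∈-map⁻ proj₁ X∈
...   | (X , t) , p∈ , refl = varsG-tagGoal⁺ p∈ (∈-++⁺ˡ x∈X)

tags⊆ : (T : Tagged Fn Pr) → tags T ⊆ varsG (tagGoal {K = K} T)
tags⊆ T t∈ with ∈-map⁻ proj₂ t∈
... | (X , t) , p∈ , refl = varsG-tagGoal⁺ p∈ (∈-++⁺ʳ (varsA X) (here refl))

module RenamedFClause {Fn Pr K : Set} (κ : K) (bs : Goal Fn Pr) (C : Atom Fn Pr)
                      (ρ : ℕ → ℕ) (ρ-inj : InjectiveFn ρ) where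

  H : Set
  H = Fn ⊎ K

  c : Clause Fn Pr K
  c = clause κ bs C

  n : ℕ
  n = suc (maxList (varsC c))

  C′ : Atom Fn Pr
  C′ = substA (ren ρ) C

  bs′ : Goal Fn Pr
  bs′ = map (substA (ren ρ)) bs

  ys : List ℕ
  ys = map (λ j → ρ (n + j)) (upTo (length bs))

  fκ : (ℕ → Term H) → Term H
  fκ g = fn (inj₂ κ) (map g ys)

  varsC′ : List ℕ
  varsC′ = varsC (renameC ρ (Fclause c))

  ⌈_⌉ : Tagged Fn Pr → Goal H Pr
  ⌈_⌉ = tagGoal {K = K}

  head′ : Atom H Pr
  head′ = head (renameC ρ (Fclause c))

  body′ : Goal H Pr
  body′ = body (renameC ρ (Fclause c))

  head-renamed : head′ ≡ embA C′ [ fκ var ]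
  head-renamed =
    trans (substA-[] (ren ρ) (embA C) _)
          (cong₂ _[_] (mapA-substA inj₁ (ren ρ) C)
                      (cong (fn (inj₂ κ)) (trans (substTs-map-var (ren ρ) (n +_) (upTo (length bs)))
                                                 (map-∘ (upTo (length bs))))))

  body-renamed : body′ ≡ ⌈ zip bs′ ys ⌉
  body-renamed = renamed-zip bs (upTo (length bs))
    where
      renamed-zip : (as : Goal Fn Pr) (js : List ℕ) →
                    map (substA (ren ρ)) (zipWith (λ B j → embA B [ var (n + j) ]) as js)
                    ≡ ⌈ zip (map (substA (ren ρ)) as) (map (λ j → ρ (n + j)) js) ⌉
      renamed-zip []       js       = refl
      renamed-zip (A ∷ as) []       = refl
      renamed-zip (A ∷ as) (j ∷ js) =
        cong₂ _∷_ (trans (substA-[] (ren ρ) (embA A) _)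
                         (cong (_[ var (ρ (n + j)) ]) (mapA-substA inj₁ (ren ρ) A)))
                  (renamed-zip as js)

  length-bs′≡length-ys : length bs′ ≡ length ys
  length-bs′≡length-ys =
    trans (length-map (substA (ren ρ)) bs)
          (sym (trans (length-map _ (upTo (length bs))) (length-upTo (length bs))))

  atoms-body : atoms (zip bs′ ys) ≡ bs′
  atoms-body = map-proj₁-zip bs′ ys length-bs′≡length-ys

  tags-body : tags (zip bs′ ys) ≡ ys
  tags-body = map-proj₂-zip bs′ ys length-bs′≡length-ys

  Unique-ys : Unique ys
  Unique-ys = Unique.map⁺ (λ eq → +-cancelˡ-≡ n _ _ (ρ-inj eq)) (Unique.upTo⁺ (length bs))

  -- ys are images of variables ≥ n, the clause's own variables are images of variables < n.
  ys-fresh : {a v : ℕ} → a ∈ varsC c → v ∈ ys → v ≢ ρ a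
  ys-fresh {a} a∈ v∈ refl with ∈-map⁻ (λ j → ρ (n + j)) v∈
  ... | j , _ , eq = ≤⇒≯ (m≤m+n n j) (subst (_< n) (ρ-inj eq) (s≤s (≤-maxList (varsC c) a∈)))

  ys-fresh-C′ : Disjoint ys (varsA C′)
  ys-fresh-C′ (v∈ys , v∈C′) with varsA-ren⁻ ρ C v∈C′
  ... | a , a∈ , v≡ρa = ys-fresh (∈-++⁺ʳ (varsG bs) a∈) v∈ys v≡ρa

  ys-fresh-bs′ : Disjoint ys (varsG bs′)
  ys-fresh-bs′ (v∈ys , v∈bs′) with varsG-ren⁻ ρ bs v∈bs′
  ... | a , a∈ , v≡ρa = ys-fresh (∈-++⁺ˡ a∈) v∈ys v≡ρa

  head⊆varsC′ : varsA (embA {K = K} C′) ++ varsT (fκ var) ⊆ varsC′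
  head⊆varsC′ v∈ =
    ∈-++⁺ʳ (varsG body′)
           (subst (λ h → _ ∈ varsA h) (sym head-renamed) (subst (_ ∈_) (sym (varsA-[] (embA C′) (fκ var))) v∈))

  C′⊆varsC′ : varsA C′ ⊆ varsC′
  C′⊆varsC′ v∈ = head⊆varsC′ (∈-++⁺ˡ (subst (_ ∈_) (sym (varsA-mapA inj₁ C′)) v∈))

  ys⊆varsC′ : ys ⊆ varsC′
  ys⊆varsC′ v∈ = head⊆varsC′ (∈-++⁺ʳ (varsA (embA C′)) (subst (_ ∈_) (sym (varsTs-map-var ys)) v∈))

  bs′⊆varsC′ : varsG bs′ ⊆ varsC′
  bs′⊆varsC′ v∈ =
    ∈-++⁺ˡ (subst (λ g → _ ∈ varsG g) (sym body-renamed)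
                  (varsG-atoms⊆ (zip bs′ ys) (subst (λ g → _ ∈ varsG g) (sym atoms-body) v∈)))

  ρ-varsC′ : {a : ℕ} → a ∈ varsC c → ρ a ∈ varsC′
  ρ-varsC′ {a} a∈ with ∈-++⁻ (varsG bs) a∈
  ... | inj₂ a∈C  = C′⊆varsC′ (varsA-substA⁺ (ren ρ) C a∈C (here refl))
  ... | inj₁ a∈bs with varsG⁻ bs a∈bs
  ...   | B , B∈ , a∈B =
    bs′⊆varsC′ (varsG⁺ (∈-map⁺ (substA (ren ρ)) B∈) (varsA-substA⁺ (ren ρ) B a∈B (here refl)))

-- A step of F(Φ) resolving the atom (X , z) of T with F(κ) renamed by ρ.  The variables Ys are
-- the tags after the step; a variable that is neither z nor in Ys is ordinary.

module ResolutionStep {Fn Pr K : Set} (TL TR : Tagged Fn Pr) (X : Atom Fn Pr) (z : ℕ)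
                      (κ : K) (bs : Goal Fn Pr) (C : Atom Fn Pr)
                      (ρ : ℕ → ℕ) (ρ-inj : InjectiveFn ρ) where

  open RenamedFClause κ bs C ρ ρ-inj public

  T : Tagged Fn Pr
  T = TL ++ (X , z) ∷ TR

  T′ : Tagged Fn Pr
  T′ = TL ++ zip bs′ ys ++ TR

  Ys : List ℕ
  Ys = ys ++ tags TL ++ tags TR

  Ordinary : ℕ → Set
  Ordinary x = x ≢ z × x ∉ Ys

  lift : Subst Fn → (ℕ → Term H) → Subst H
  lift u g x with x ≟ z | x ∈? Ys
  ... | yes _ | _     = fκ g
  ... | no _  | yes _ = g x
  ... | no _  | no _  = embT (u x)

  lift-z : (u : Subst Fn) (g : ℕ → Term H) → lift u g z ≡ fκ g
  lift-z u g with z ≟ z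
  ... | yes _  = refl
  ... | no z≢z = ⊥-elim (z≢z refl)

  lift-Ys : (u : Subst Fn) (g : ℕ → Term H) {x : ℕ} → x ≢ z → x ∈ Ys → lift u g x ≡ g x
  lift-Ys u g {x} x≢z x∈ with x ≟ z | x ∈? Ys
  ... | yes x≡z | _      = ⊥-elim (x≢z x≡z)
  ... | no _    | yes _  = refl
  ... | no _    | no x∉  = ⊥-elim (x∉ x∈)

  lift-ordinary : (u : Subst Fn) (g : ℕ → Term H) {x : ℕ} → Ordinary x → lift u g x ≡ embT (u x)
  lift-ordinary u g {x} (x≢z , x∉) with x ≟ z | x ∈? Ys
  ... | yes x≡z | _      = ⊥-elim (x≢z x≡z)
  ... | no _    | yes x∈ = ⊥-elim (x∉ x∈)
  ... | no _    | no _   = refl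

  tags-T : tags T ≡ tags TL ++ z ∷ tags TR
  tags-T = map-++ proj₂ TL ((X , z) ∷ TR)

  atoms-T : atoms T ≡ atoms TL ++ X ∷ atoms TR
  atoms-T = map-++ proj₁ TL ((X , z) ∷ TR)

  tags-T′ : tags T′ ≡ tags TL ++ ys ++ tags TR
  tags-T′ = trans (map-++ proj₂ TL (zip bs′ ys ++ TR))
                  (cong (tags TL ++_) (trans (map-++ proj₂ (zip bs′ ys) TR) (cong (_++ tags TR) tags-body)))

  atoms-T′ : atoms T′ ≡ atoms TL ++ bs′ ++ atoms TR
  atoms-T′ = trans (map-++ proj₁ TL (zip bs′ ys ++ TR))
                   (cong (atoms TL ++_)
                         (trans (map-++ proj₁ (zip bs′ ys) TR) (cong (_++ atoms TR) atoms-body)))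

  tagGoal-T : ⌈ T ⌉ ≡ ⌈ TL ⌉ ++ tagAtom (X , z) ∷ ⌈ TR ⌉
  tagGoal-T = map-++ tagAtom TL ((X , z) ∷ TR)

  tagGoal-T′ : ⌈ T′ ⌉ ≡ ⌈ TL ⌉ ++ body′ ++ ⌈ TR ⌉
  tagGoal-T′ = trans (map-++ tagAtom TL (zip bs′ ys ++ TR))
                     (cong (⌈ TL ⌉ ++_)
                           (trans (map-++ tagAtom (zip bs′ ys) TR) (cong (_++ ⌈ TR ⌉) (sym body-renamed))))

  varsG-atoms-T : varsG (atoms T) ≡ varsG (atoms TL) ++ varsA X ++ varsG (atoms TR)
  varsG-atoms-T = trans (cong varsG atoms-T) (varsG-++ (atoms TL) (X ∷ atoms TR))

  varsG-atoms-T′ : varsG (atoms T′) ≡ varsG (atoms TL) ++ varsG bs′ ++ varsG (atoms TR)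
  varsG-atoms-T′ =
    trans (cong varsG atoms-T′)
          (trans (varsG-++ (atoms TL) (bs′ ++ atoms TR)) (cong (varsG (atoms TL) ++_) (varsG-++ bs′ (atoms TR))))

  module Apart (well : WellTagged T) (apart : Disjoint varsC′ (varsG ⌈ T ⌉)) where

    z∉others : z ∉ tags TL ++ tags TR
    z∉others = proj₁ (Unique-remove (tags TL) (subst Unique tags-T (proj₁ well)))

    Unique-others : Unique (tags TL ++ tags TR)
    Unique-others = proj₂ (Unique-remove (tags TL) (subst Unique tags-T (proj₁ well)))

    tags-T⁺ : {t : ℕ} → t ∈ tags TL ++ z ∷ tags TR → t ∈ tags T
    tags-T⁺ t∈ = subst (_ ∈_) (sym tags-T) t∈

    z∈tags-T : z ∈ tags T
    z∈tags-T = tags-T⁺ (∈-++⁺ʳ (tags TL) (here refl))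

    others⊆tags-T : tags TL ++ tags TR ⊆ tags T
    others⊆tags-T t∈ with ∈-++⁻ (tags TL) t∈
    ... | inj₁ t∈L = tags-T⁺ (∈-++⁺ˡ t∈L)
    ... | inj₂ t∈R = tags-T⁺ (∈-++⁺ʳ (tags TL) (there t∈R))

    atoms-T⁺ : {x : ℕ} → x ∈ varsG (atoms TL) ++ varsA X ++ varsG (atoms TR) → x ∈ varsG (atoms T)
    atoms-T⁺ x∈ = subst (_ ∈_) (sym varsG-atoms-T) x∈

    clause≢z : {v : ℕ} → v ∈ varsC′ → v ≢ z
    clause≢z v∈ refl = apart (v∈ , tags⊆ T z∈tags-T)

    clause∉others : {v : ℕ} → v ∈ varsC′ → v ∉ tags TL ++ tags TR
    clause∉others v∈ v∈others = apart (v∈ , tags⊆ T (others⊆tags-T v∈others))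

    goal-ordinary : {x : ℕ} → x ∈ varsG (atoms T) → Ordinary x
    goal-ordinary x∈ = (λ { refl → proj₂ well (z∈tags-T , x∈) }) , not-Ys
      where
        not-Ys : _ ∉ Ys
        not-Ys x∈Ys with ∈-++⁻ ys x∈Ys
        ... | inj₁ x∈ys     = apart (ys⊆varsC′ x∈ys , varsG-atoms⊆ T x∈)
        ... | inj₂ x∈others = proj₂ well (others⊆tags-T x∈others , x∈)

    clause-ordinary : {v : ℕ} → v ∈ varsC′ → v ∉ ys → Ordinary v
    clause-ordinary v∈ v∉ys =
      clause≢z v∈ , λ v∈Ys → [ v∉ys , clause∉others v∈ ]′ (∈-++⁻ ys v∈Ys)

    varsA-X⊆ : varsA X ⊆ varsG (atoms T)
    varsA-X⊆ x∈ = atoms-T⁺ (∈-++⁺ʳ (varsG (atoms TL)) (∈-++⁺ˡ x∈))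

    varsG-TL⊆ : varsG (atoms TL) ⊆ varsG (atoms T)
    varsG-TL⊆ x∈ = atoms-T⁺ (∈-++⁺ˡ x∈)

    varsG-TR⊆ : varsG (atoms TR) ⊆ varsG (atoms T)
    varsG-TR⊆ x∈ = atoms-T⁺ (∈-++⁺ʳ (varsG (atoms TL)) (∈-++⁺ʳ (varsA X) x∈))

    X-ordinary : {x : ℕ} → x ∈ varsA X → Ordinary x
    X-ordinary x∈ = goal-ordinary (varsA-X⊆ x∈)

    C′-ordinary : {x : ℕ} → x ∈ varsA C′ → Ordinary x
    C′-ordinary x∈ = clause-ordinary (C′⊆varsC′ x∈) (λ x∈ys → ys-fresh-C′ (x∈ys , x∈))

    Ys≢z : {x : ℕ} → x ∈ Ys → x ≢ z
    Ys≢z x∈ with ∈-++⁻ ys x∈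
    ... | inj₁ x∈ys     = clause≢z (ys⊆varsC′ x∈ys)
    ... | inj₂ x∈others = λ { refl → z∉others x∈others }

    tags-T′⊆Ys : tags T′ ⊆ Ys
    tags-T′⊆Ys t∈ with ∈-++⁻ (tags TL) (subst (_ ∈_) tags-T′ t∈)
    ... | inj₁ t∈L = ∈-++⁺ʳ ys (∈-++⁺ˡ t∈L)
    ... | inj₂ t∈ with ∈-++⁻ ys t∈
    ...   | inj₁ t∈ys = ∈-++⁺ˡ t∈ys
    ...   | inj₂ t∈R  = ∈-++⁺ʳ ys (∈-++⁺ʳ (tags TL) t∈R)

    atoms-T′-ordinary : {x : ℕ} → x ∈ varsG (atoms T′) → Ordinary x
    atoms-T′-ordinary x∈ with ∈-++⁻ (varsG (atoms TL)) (subst (_ ∈_) varsG-atoms-T′ x∈)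
    ... | inj₁ x∈L = goal-ordinary (varsG-TL⊆ x∈L)
    ... | inj₂ x∈ with ∈-++⁻ (varsG bs′) x∈
    ...   | inj₁ x∈bs′ =
      clause-ordinary (bs′⊆varsC′ x∈bs′) (λ x∈ys → ys-fresh-bs′ (x∈ys , x∈bs′))
    ...   | inj₂ x∈R   = goal-ordinary (varsG-TR⊆ x∈R)

    Unique-tags-T′ : Unique (tags T′)
    Unique-tags-T′ = subst Unique (sym tags-T′)
      (Unique-insert (tags TL) ys (tags TR) Unique-others Unique-ys
        (λ (v∈ys , v∈others) → clause∉others (ys⊆varsC′ v∈ys) v∈others))

    substA-lift-embA : (u : Subst Fn) (g : ℕ → Term H) (A : Atom Fn Pr) →
                       (∀ {x} → x ∈ varsA A → Ordinary x) → substA (lift u g) (embA A) ≡ embA (substA u A)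
    substA-lift-embA u g A ordinary =
      trans (substA-cong (embA A) (λ x x∈ → lift-ordinary u g (ordinary (subst (_ ∈_) (varsA-mapA inj₁ A) x∈))))
            (mapA-substA inj₁ u A)

    lift-unifies : (u : Subst Fn) (g : ℕ → Term H) → substA u C′ ≡ substA u X →
                   Unifier (lift u g) head′ (tagAtom (X , z))
    lift-unifies u g uC′≡uX = begin
      substA (lift u g) head′
        ≡⟨ cong (substA (lift u g)) head-renamed ⟩
      substA (lift u g) (embA C′ [ fκ var ])
        ≡⟨ substA-[] (lift u g) (embA C′) (fκ var) ⟩
      substA (lift u g) (embA C′) [ substT (lift u g) (fκ var) ]
        ≡⟨ cong₂ _[_] (substA-lift-embA u g C′ C′-ordinary) lift-fκ ⟩
      embA (substA u C′) [ fκ g ]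
        ≡⟨ cong (λ A → embA A [ fκ g ]) uC′≡uX ⟩
      embA (substA u X) [ fκ g ]
        ≡⟨ sym (cong₂ _[_] (substA-lift-embA u g X X-ordinary) (lift-z u g)) ⟩
      substA (lift u g) (embA X) [ lift u g z ]
        ≡⟨ sym (substA-[] (lift u g) (embA X) (var z)) ⟩
      substA (lift u g) (tagAtom (X , z)) ∎
      where
        open ≡-Reasoning
        lift-fκ : substT (lift u g) (fκ var) ≡ fκ g
        lift-fκ = cong (fn (inj₂ κ)) (trans (substTs-map-var (lift u g) (λ y → y) ys)
                    (map-cong-local (All.tabulate λ y∈ →
                       lift-Ys u g (clause≢z (ys⊆varsC′ y∈)) (∈-++⁺ˡ y∈))))

    -- What an mgu μ of the selected atom and the head of F(κ) looks like: it sends every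
    -- variable of Ys to a variable and every ordinary variable to an f_κ-free term.
    module WithMGU (μ : Subst H) (mgu : MGU μ head′ (tagAtom (X , z))) where

      μ̂ : Subst Fn
      μ̂ x = eraseT (μ x)

      μ̂-unifies : substA μ̂ C′ ≡ substA μ̂ X
      μ̂-unifies = begin
        substA μ̂ C′                      ≡⟨ sym (eraseA-substA-embA μ C′) ⟩
        eraseA (substA μ (embA C′))        ≡⟨ cong eraseA (proj₁ ([]-injective _ _ _ _ μC′[]≡μX[])) ⟩
        eraseA (substA μ (embA X))         ≡⟨ eraseA-substA-embA μ X ⟩
        substA μ̂ X                        ∎
        where
          open ≡-Reasoning
          μC′[]≡μX[] : substA μ (embA C′) [ substT μ (fκ var) ] ≡ substA μ (embA X) [ μ z ]
          μC′[]≡μX[] =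
            trans (sym (substA-[] μ (embA C′) (fκ var)))
                  (trans (cong (substA μ) (sym head-renamed))
                         (trans (proj₁ mgu) (substA-[] μ (embA X) (var z))))

      μ-general : (u : Subst Fn) (g : ℕ → Term H) → substA u C′ ≡ substA u X →
                  ∃[ δ ] (∀ x → lift u g x ≡ substT δ (μ x))
      μ-general u g uC′≡uX = proj₂ mgu (lift u g) (lift-unifies u g uC′≡uX)

      μ̂-general : (s : Subst Fn) → substA s C′ ≡ substA s X →
                  ∃[ δ ] (∀ x → x ≢ z → s x ≡ substT δ (μ̂ x))
      μ̂-general s sC′≡sX with δ , factors ← μ-general s (λ x → embT (s x)) sC′≡sX =
        (λ v → eraseT (δ v)) , factors-off-z
        where
          lift-off-z : ∀ x → x ≢ z → lift s (λ x → embT (s x)) x ≡ embT (s x)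
          lift-off-z x x≢z = case x ∈? Ys of λ where
            (yes x∈) → lift-Ys s _ x≢z x∈
            (no x∉)  → lift-ordinary s _ (x≢z , x∉)
          factors-off-z : ∀ x → x ≢ z → s x ≡ substT (λ v → eraseT (δ v)) (μ̂ x)
          factors-off-z x x≢z = begin
            s x                                   ≡⟨ sym (eraseT-embT (s x)) ⟩
            eraseT (embT (s x))                   ≡⟨ cong eraseT s≡δμ ⟩
            eraseT (substT δ (μ x))
              ≡⟨ cong (λ t → eraseT (substT δ t)) (substT≡embT⇒embT δ (μ x) (sym s≡δμ)) ⟩
            eraseT (substT δ (embT (μ̂ x)))        ≡⟨ eraseT-substT-embT δ (μ̂ x) ⟩
            substT (λ v → eraseT (δ v)) (μ̂ x)     ∎
            where
              open ≡-Reasoning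
              s≡δμ : embT (s x) ≡ substT δ (μ x)
              s≡δμ = trans (sym (lift-off-z x x≢z)) (factors x)

      -- Shifting μ̂ above Ys and lifting it with the identity on Ys gives a unifier through
      -- which μ factors; this pins down μ on Ys and keeps ordinary variables away from Ys.
      bound : ℕ
      bound = suc (maxList Ys)

      shift : Subst Fn
      shift v = var (bound + v)

      δ₂-factors : ∃[ δ ] (∀ x → lift (shift ∘ₛ μ̂) var x ≡ substT δ (μ x))
      δ₂-factors = μ-general (shift ∘ₛ μ̂) var (begin
        substA (shift ∘ₛ μ̂) C′          ≡⟨ sym (substA-∘ shift μ̂ C′) ⟩
        substA shift (substA μ̂ C′)      ≡⟨ cong (substA shift) μ̂-unifies ⟩
        substA shift (substA μ̂ X)       ≡⟨ substA-∘ shift μ̂ X ⟩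
        substA (shift ∘ₛ μ̂) X           ∎)
        where open ≡-Reasoning

      δ₂ : Subst H
      δ₂ = proj₁ δ₂-factors

      δ₂μ-Ys : {x : ℕ} → x ∈ Ys → substT δ₂ (μ x) ≡ var x
      δ₂μ-Ys {x} x∈ = trans (sym (proj₂ δ₂-factors x)) (lift-Ys (shift ∘ₛ μ̂) var (Ys≢z x∈) x∈)

      μ-Ys : {x : ℕ} → x ∈ Ys → μ x ≡ var (varOf (μ x))
      μ-Ys {x} x∈ = substT≡var⇒var δ₂ (μ x) (δ₂μ-Ys x∈)

      δ₂-varOf-μ : {x : ℕ} → x ∈ Ys → δ₂ (varOf (μ x)) ≡ var x
      δ₂-varOf-μ {x} x∈ = trans (cong (substT δ₂) (sym (μ-Ys x∈))) (δ₂μ-Ys x∈)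

      δ₂μ-ordinary : {x : ℕ} → Ordinary x → substT δ₂ (μ x) ≡ embT ((shift ∘ₛ μ̂) x)
      δ₂μ-ordinary {x} o = trans (sym (proj₂ δ₂-factors x)) (lift-ordinary (shift ∘ₛ μ̂) var o)

      μ-ordinary : {x : ℕ} → Ordinary x → μ x ≡ embT (μ̂ x)
      μ-ordinary {x} o = substT≡embT⇒embT δ₂ (μ x) (δ₂μ-ordinary o)

      Ys-below-bound : {x : ℕ} → x ∈ Ys → x < bound
      Ys-below-bound x∈ = s≤s (≤-maxList Ys x∈)

      ordinary-above-bound : {x v w : ℕ} → Ordinary x →
                             v ∈ varsT (μ x) → w ∈ varsT (δ₂ v) → bound ≤ w
      ordinary-above-bound {x} o v∈ w∈ with varsT-substT⁻ shift (μ̂ x) w∈shifted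
        where
          w∈shifted : _ ∈ varsT ((shift ∘ₛ μ̂) x)
          w∈shifted = subst (_ ∈_) (varsT-mapT inj₁ ((shift ∘ₛ μ̂) x))
                        (subst (λ t → _ ∈ varsT t) (δ₂μ-ordinary o) (varsT-substT⁺ δ₂ (μ x) v∈ w∈))
      ... | y , _ , here refl = m≤m+n bound y

      update : Atom Fn Pr × ℕ → Atom Fn Pr × ℕ
      update (Y , t) = substA μ̂ Y , varOf (μ t)

      T₁ : Tagged Fn Pr
      T₁ = map update T′

      tagAtom-update : {p : Atom Fn Pr × ℕ} → p ∈ T′ → substA μ (tagAtom p) ≡ tagAtom (update p)
      tagAtom-update {Y , t} p∈ =
        trans (substA-[] μ (embA Y) (var t))
              (cong₂ _[_] (trans (substA-cong (embA Y) (λ x x∈ → μ-ordinary (Y-ordinary x∈)))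
                                 (mapA-substA inj₁ μ̂ Y))
                          (μ-Ys (tags-T′⊆Ys (∈-map⁺ proj₂ p∈))))
        where
          Y-ordinary : {x : ℕ} → x ∈ varsA (embA {K = K} Y) → Ordinary x
          Y-ordinary x∈ =
            atoms-T′-ordinary (varsG⁺ (∈-map⁺ proj₁ p∈) (subst (_ ∈_) (varsA-mapA inj₁ Y) x∈))

      tagGoal-T₁ : ⌈ T₁ ⌉ ≡ substG μ ⌈ T′ ⌉
      tagGoal-T₁ =
        trans (sym (map-∘ T′)) (trans (sym (map-cong-local (All.tabulate tagAtom-update))) (map-∘ T′))

      tagGoal-T₁-split : ⌈ T₁ ⌉ ≡ substG μ ⌈ TL ⌉ ++ substG μ body′ ++ substG μ ⌈ TR ⌉
      tagGoal-T₁-split =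
        trans tagGoal-T₁ (trans (cong (substG μ) tagGoal-T′) (substG-++₃ μ ⌈ TL ⌉ body′ ⌈ TR ⌉))

      atoms-T₁ : atoms T₁ ≡ substG μ̂ (atoms T′)
      atoms-T₁ = trans (sym (map-∘ T′)) (map-∘ T′)

      tags-T₁ : tags T₁ ≡ map (λ t → varOf (μ t)) (tags T′)
      tags-T₁ = trans (sym (map-∘ T′)) (map-∘ T′)

      well-T₁ : WellTagged T₁
      well-T₁ = subst Unique (sym tags-T₁) (Unique.map⁻ (subst Unique (sym back) Unique-tags-T′)) , tags#atoms
        where
          back : map (λ t → varOf (δ₂ t)) (map (λ t → varOf (μ t)) (tags T′)) ≡ tags T′
          back = trans (sym (map-∘ (tags T′)))
                       (trans (map-cong-local (All.tabulate λ t∈ → cong varOf (δ₂-varOf-μ (tags-T′⊆Ys t∈))))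
                              (map-id (tags T′)))
          tags#atoms : Disjoint (tags T₁) (varsG (atoms T₁))
          tags#atoms (w∈tags , w∈atoms)
            with ∈-map⁻ (λ t → varOf (μ t)) (subst (_ ∈_) tags-T₁ w∈tags)
               | varsG-substG⁻ μ̂ (atoms T′) (subst (λ g → _ ∈ varsG g) atoms-T₁ w∈atoms)
          ... | t , t∈ , refl | x , x∈ , w∈μ̂x =
            ≤⇒≯ (ordinary-above-bound (atoms-T′-ordinary x∈) w∈μx t∈δ₂w)
                (Ys-below-bound (tags-T′⊆Ys t∈))
            where
              w∈μx : varOf (μ t) ∈ varsT (μ x)
              w∈μx = subst (λ u → _ ∈ varsT u) (sym (μ-ordinary (atoms-T′-ordinary x∈)))
                           (subst (_ ∈_) (sym (varsT-mapT inj₁ (μ̂ x))) w∈μ̂x)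
              t∈δ₂w : t ∈ varsT (δ₂ (varOf (μ t)))
              t∈δ₂w = subst (λ u → t ∈ varsT u) (sym (δ₂-varOf-μ (tags-T′⊆Ys t∈))) (here refl)

      atoms-T′-z-free : {x : ℕ} → x ∈ varsG (atoms T′) → x ≢ z
      atoms-T′-z-free x∈ = proj₁ (atoms-T′-ordinary x∈)

-- Renamings with a decidable inverse

parity : ℕ → ℕ ⊎ ℕ
parity zero          = inj₁ zero
parity (suc zero)    = inj₂ zero
parity (suc (suc n)) = Sum.map suc suc (parity n)

parity-even : (k : ℕ) → parity (k + k) ≡ inj₁ k
parity-even zero    = refl
parity-even (suc k) rewrite +-suc k k | parity-even k = refl

parity-odd : (k : ℕ) → parity (suc (k + k)) ≡ inj₂ k
parity-odd zero    = refl
parity-odd (suc k) rewrite +-suc k k | parity-odd k = refl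

parity-inj₁ : (n k : ℕ) → parity n ≡ inj₁ k → k + k ≡ n
parity-inj₁ zero          zero refl = refl
parity-inj₁ (suc zero)    k    ()
parity-inj₁ (suc (suc n)) k    eq with parity n in eqn
parity-inj₁ (suc (suc n)) .(suc k) refl | inj₁ k rewrite +-suc k k =
  cong (λ m → suc (suc m)) (parity-inj₁ n k eqn)

record Renaming : Set where
  field
    rename          : ℕ → ℕ
    preimage        : ℕ → Maybe ℕ
    preimage-rename : ∀ y → preimage (rename y) ≡ just y
    rename-preimage : ∀ {x y} → preimage x ≡ just y → rename y ≡ x

  rename-injective : InjectiveFn rename
  rename-injective {a} {b} eq =
    just-injective (trans (sym (preimage-rename a)) (trans (cong preimage eq) (preimage-rename b)))
    where
      just-injective : {a b : ℕ} → just a ≡ just b → a ≡ b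
      just-injective refl = refl

identity : Renaming
identity = record
  { rename          = λ x → x
  ; preimage        = just
  ; preimage-rename = λ _ → refl
  ; rename-preimage = λ { refl → refl }
  }

doubling : Renaming
doubling = record
  { rename          = λ x → x + x
  ; preimage        = half
  ; preimage-rename = λ y → cong [ just , const nothing ]′ (parity-even y)
  ; rename-preimage = λ {x} → double-half x
  }
  where
    half : ℕ → Maybe ℕ
    half x = [ just , const nothing ]′ (parity x)
    double-half : ∀ x {y} → half x ≡ just y → y + y ≡ x
    double-half x eq with parity x in eqx
    double-half x refl | inj₁ y = parity-inj₁ x y eqx

-- A step of F(Φ) yields a step of Φ on the goal renamed by π.  Its mgu γ doubles the variables
-- of μ̂, leaving the odd ones free for π z and for the variables outside the image of π.

module SoundnessStep {Fn Pr K : Set} (Φ : Program Fn Pr K)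
                     (TL TR : Tagged Fn Pr) (X : Atom Fn Pr) (z : ℕ)
                     (κ : K) (bs : Goal Fn Pr) (C : Atom Fn Pr) (c∈Φ : clause κ bs C ∈ Φ)
                     (ρ : ℕ → ℕ) (ρ-inj : InjectiveFn ρ) where

  open ResolutionStep TL TR X z κ bs C ρ ρ-inj public

  module _ (well : WellTagged T) (apart : Disjoint varsC′ (varsG ⌈ T ⌉))
           (μ : Subst H) (mgu : MGU μ head′ (tagAtom (X , z))) (π : Renaming) where

    open Apart well apart
    open WithMGU μ mgu
    open Renaming π

    π̂ : Subst Fn
    π̂ = ren rename

    dbl : Subst Fn
    dbl = ren (Renaming.rename doubling)

    odd : ℕ → Term Fn
    odd x = var (suc (x + x))

    γ-on : ℕ → Maybe ℕ → Term Fn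
    γ-on x nothing  = odd x
    γ-on x (just y) with y ≟ z
    ... | yes _ = odd x
    ... | no _  = substT dbl (μ̂ y)

    γ : Subst Fn
    γ x = γ-on x (preimage x)

    γ-rename : (y : ℕ) → y ≢ z → γ (rename y) ≡ substT dbl (μ̂ y)
    γ-rename y y≢z rewrite preimage-rename y with y ≟ z
    ... | yes y≡z = ⊥-elim (y≢z y≡z)
    ... | no _    = refl

    γπ̂-atom : (A : Atom Fn Pr) → (∀ {x} → x ∈ varsA A → x ≢ z) →
              substA γ (substA π̂ A) ≡ substA dbl (substA μ̂ A)
    γπ̂-atom A z-free =
      trans (substA-∘ γ π̂ A)
            (trans (substA-cong A (λ x x∈ → γ-rename x (z-free x∈))) (sym (substA-∘ dbl μ̂ A)))

    γπ̂-goal : (Gs : Goal Fn Pr) → (∀ {x} → x ∈ varsG Gs → x ≢ z) →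
              substG γ (substG π̂ Gs) ≡ substG dbl (substG μ̂ Gs)
    γπ̂-goal Gs z-free =
      trans (substG-∘ γ π̂ Gs)
            (trans (substG-cong Gs (λ x x∈ → γ-rename x (z-free x∈))) (sym (substG-∘ dbl μ̂ Gs)))

    renamed-clause : Clause Fn Pr K
    renamed-clause = renameC (λ x → rename (ρ x)) c

    goal : Goal Fn Pr
    goal = substG π̂ (atoms TL) ++ substA π̂ X ∷ substG π̂ (atoms TR)

    goal-π̂ : substG π̂ (atoms T) ≡ goal
    goal-π̂ = trans (cong (substG π̂) atoms-T) (substG-++ π̂ (atoms TL) (X ∷ atoms TR))

    renamed-apart : ∀ v → v ∈ varsC renamed-clause → v ∉ varsG goal
    renamed-apart v v∈clause v∈goal
      with varsC-renameC⁻ (λ x → rename (ρ x)) c v∈clause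
         | varsG-ren⁻ rename (atoms T) (subst (λ g → v ∈ varsG g) (sym goal-π̂) v∈goal)
    ... | a , a∈ , refl | w , w∈ , eq =
      apart (ρ-varsC′ a∈ , subst (_∈ varsG ⌈ T ⌉) (sym (rename-injective eq)) (varsG-atoms⊆ T w∈))

    γ-unifies : Unifier γ (head renamed-clause) (substA π̂ X)
    γ-unifies = begin
      substA γ (head renamed-clause) ≡⟨ cong (substA γ) (sym (substA-∘ π̂ (ren ρ) C)) ⟩
      substA γ (substA π̂ C′)       ≡⟨ γπ̂-atom C′ (λ x∈ → proj₁ (C′-ordinary x∈)) ⟩
      substA dbl (substA μ̂ C′)     ≡⟨ cong (substA dbl) μ̂-unifies ⟩
      substA dbl (substA μ̂ X)      ≡⟨ sym (γπ̂-atom X (λ x∈ → proj₁ (X-ordinary x∈))) ⟩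
      substA γ (substA π̂ X)        ∎
      where open ≡-Reasoning

    γ-general : (σ : Subst Fn) → Unifier σ (head renamed-clause) (substA π̂ X) →
                ∃[ δ ] (∀ x → σ x ≡ substT δ (γ x))
    γ-general σ σ-unifies = δ , factors
      where
        open ≡-Reasoning
        δ₀-factors : ∃[ δ₀ ] (∀ y → y ≢ z → (σ ∘ₛ π̂) y ≡ substT δ₀ (μ̂ y))
        δ₀-factors = μ̂-general (σ ∘ₛ π̂) (begin
          substA (σ ∘ₛ π̂) C′             ≡⟨ sym (substA-∘ σ π̂ C′) ⟩
          substA σ (substA π̂ C′)          ≡⟨ cong (substA σ) (substA-∘ π̂ (ren ρ) C) ⟩
          substA σ (head renamed-clause)   ≡⟨ σ-unifies ⟩
          substA σ (substA π̂ X)           ≡⟨ substA-∘ σ π̂ X ⟩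
          substA (σ ∘ₛ π̂) X              ∎)
        δ₀ = proj₁ δ₀-factors
        δ : Subst Fn
        δ v = [ δ₀ , σ ]′ (parity v)
        δ-odd : ∀ x → σ x ≡ substT δ (odd x)
        δ-odd x rewrite parity-odd x = refl
        δ-dbl : ∀ t → substT δ (substT dbl t) ≡ substT δ₀ t
        δ-dbl t = trans (substT-∘ δ dbl t) (substT-cong t (λ v _ → cong [ δ₀ , σ ]′ (parity-even v)))
        factors : ∀ x → σ x ≡ substT δ (γ x)
        factors x with preimage x in eq
        ... | nothing = δ-odd x
        ... | just y with y ≟ z
        ...   | yes _   = δ-odd x
        ...   | no y≢z  = begin
          σ x                        ≡⟨ cong σ (sym (rename-preimage eq)) ⟩
          σ (rename y)               ≡⟨ proj₂ δ₀-factors y y≢z ⟩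
          substT δ₀ (μ̂ y)            ≡⟨ sym (δ-dbl (μ̂ y)) ⟩
          substT δ (substT dbl (μ̂ y)) ∎

    resolvent : substG γ (substG π̂ (atoms TL)) ++ substG γ (body renamed-clause) ++ substG γ (substG π̂ (atoms TR))
                ≡ substG dbl (atoms T₁)
    resolvent = begin
      substG γ (substG π̂ (atoms TL)) ++ substG γ (body renamed-clause) ++ substG γ (substG π̂ (atoms TR))
        ≡⟨ cong (λ b → substG γ (substG π̂ (atoms TL)) ++ substG γ b ++ substG γ (substG π̂ (atoms TR)))
                (sym (substG-∘ π̂ (ren ρ) bs)) ⟩
      substG γ (substG π̂ (atoms TL)) ++ substG γ (substG π̂ bs′) ++ substG γ (substG π̂ (atoms TR))
        ≡⟨ sym (substG-++₃ γ (substG π̂ (atoms TL)) (substG π̂ bs′) (substG π̂ (atoms TR))) ⟩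
      substG γ (substG π̂ (atoms TL) ++ substG π̂ bs′ ++ substG π̂ (atoms TR))
        ≡⟨ cong (substG γ)
                (sym (trans (cong (substG π̂) atoms-T′) (substG-++₃ π̂ (atoms TL) bs′ (atoms TR)))) ⟩
      substG γ (substG π̂ (atoms T′))
        ≡⟨ γπ̂-goal (atoms T′) atoms-T′-z-free ⟩
      substG dbl (substG μ̂ (atoms T′))
        ≡⟨ cong (substG dbl) (sym atoms-T₁) ⟩
      substG dbl (atoms T₁) ∎
      where open ≡-Reasoning

    resolve : Φ ⊢ substG dbl (atoms T₁) ↝* [] → Φ ⊢ substG π̂ (atoms T) ↝* []
    resolve derivation =
      subst (λ g → Φ ⊢ g ↝* []) (sym goal-π̂)
        (step (substG π̂ (atoms TL)) (substA π̂ X) (substG π̂ (atoms TR)) c c∈Φ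
              (λ x → rename (ρ x)) (λ eq → ρ-inj (rename-injective eq)) renamed-apart γ (γ-unifies , γ-general)
         ◅ subst (λ g → Φ ⊢ g ↝* []) (sym resolvent) derivation)

-- A step of Φ on σ (atoms T) yields a step of F(Φ) on ⌈ T ⌉, with F(κ) renamed above all
-- variables of ⌈ T ⌉.

module CompletenessStep {Fn Pr K : Set} (Φ : Program Fn Pr K)
                        (TL TR : Tagged Fn Pr) (X : Atom Fn Pr) (z : ℕ) (σ : Subst Fn)
                        (κ : K) (bs : Goal Fn Pr) (C : Atom Fn Pr) (c∈Φ : clause κ bs C ∈ Φ)
                        (ρ : ℕ → ℕ) (γ : Subst Fn) (γ-mgu : MGU γ (substA (ren ρ) C) (substA σ X))
                        (well : WellTagged (TL ++ (X , z) ∷ TR)) where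

  N : ℕ
  N = suc (maxList (varsG (tagGoal {K = K} (TL ++ (X , z) ∷ TR))))

  open ResolutionStep TL TR X z κ bs C (N +_) (+-cancelˡ-≡ N _ _) public

  apart : Disjoint varsC′ (varsG ⌈ T ⌉)
  apart (v∈C , v∈T) with varsC-renameC⁻ (N +_) (Fclause c) v∈C
  ... | a , _ , refl = ≤⇒≯ (m≤m+n N a) (s≤s (≤-maxList (varsG ⌈ T ⌉) v∈T))

  open Apart well apart public

  s : Subst Fn
  s v with N ≤? v
  ... | yes _ = γ (ρ (v ∸ N))
  ... | no _  = substT γ (σ v)

  s-clause : (a : ℕ) → s (N + a) ≡ γ (ρ a)
  s-clause a with N ≤? N + a
  ... | yes _   = cong (λ w → γ (ρ w)) (m+n∸m≡n N a)
  ... | no N≰N+a = ⊥-elim (N≰N+a (m≤m+n N a))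

  s-goal : {v : ℕ} → v ∈ varsG (atoms T) → s v ≡ substT γ (σ v)
  s-goal {v} v∈ with N ≤? v
  ... | yes N≤v = ⊥-elim (≤⇒≯ N≤v (s≤s (≤-maxList (varsG ⌈ T ⌉) (varsG-atoms⊆ T v∈))))
  ... | no _    = refl

  σ-atoms : Tagged Fn Pr → Goal Fn Pr
  σ-atoms Q = map (λ p → substA σ (proj₁ p)) Q

  γσ-atoms : (Q : Tagged Fn Pr) → varsG (atoms Q) ⊆ varsG (atoms T) →
             substG γ (σ-atoms Q) ≡ substG s (atoms Q)
  γσ-atoms Q Q⊆T =
    trans (cong (substG γ) (map-∘ Q))
          (trans (substG-∘ γ σ (atoms Q)) (sym (substG-cong (atoms Q) (λ v v∈ → s-goal (Q⊆T v∈)))))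

  s-unifies : substA s C′ ≡ substA s X
  s-unifies = begin
    substA s C′                        ≡⟨ substA-∘ s (ren (N +_)) C ⟩
    substA (s ∘ₛ ren (N +_)) C         ≡⟨ substA-cong C (λ a _ → s-clause a) ⟩
    substA (γ ∘ₛ ren ρ) C              ≡⟨ sym (substA-∘ γ (ren ρ) C) ⟩
    substA γ (substA (ren ρ) C)        ≡⟨ proj₁ γ-mgu ⟩
    substA γ (substA σ X)              ≡⟨ substA-∘ γ σ X ⟩
    substA (γ ∘ₛ σ) X                  ≡⟨ sym (substA-cong X (λ v v∈ → s-goal (varsA-X⊆ v∈))) ⟩
    substA s X                         ∎
    where open ≡-Reasoning

  F-mgu : ∃[ μ ] MGU μ head′ (tagAtom (X , z))
  F-mgu = unifiable⇒mgu head′ (tagAtom (X , z)) (lift-unifies s (λ x → embT (s x)) s-unifies)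

  open WithMGU (proj₁ F-mgu) (proj₂ F-mgu) public

  δ₀-factors : ∃[ δ₀ ] (∀ x → x ≢ z → s x ≡ substT δ₀ (μ̂ x))
  δ₀-factors = μ̂-general s s-unifies

  δ₀ : Subst Fn
  δ₀ = proj₁ δ₀-factors

  resolvent : substG γ (σ-atoms TL) ++ substG γ (body (renameC ρ c)) ++ substG γ (σ-atoms TR)
              ≡ substG δ₀ (atoms T₁)
  resolvent = begin
    substG γ (σ-atoms TL) ++ substG γ (body (renameC ρ c)) ++ substG γ (σ-atoms TR)
      ≡⟨ cong₂ _++_ (γσ-atoms TL varsG-TL⊆) (cong₂ _++_ γ-body (γσ-atoms TR varsG-TR⊆)) ⟩
    substG s (atoms TL) ++ substG s bs′ ++ substG s (atoms TR)
      ≡⟨ sym (trans (cong (substG s) atoms-T′) (substG-++₃ s (atoms TL) bs′ (atoms TR))) ⟩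
    substG s (atoms T′)
      ≡⟨ substG-cong (atoms T′) (λ x x∈ → proj₂ δ₀-factors x (atoms-T′-z-free x∈)) ⟩
    substG (δ₀ ∘ₛ μ̂) (atoms T′)
      ≡⟨ sym (substG-∘ δ₀ μ̂ (atoms T′)) ⟩
    substG δ₀ (substG μ̂ (atoms T′))
      ≡⟨ cong (substG δ₀) (sym atoms-T₁) ⟩
    substG δ₀ (atoms T₁) ∎
    where
      open ≡-Reasoning
      γ-body : substG γ (body (renameC ρ c)) ≡ substG s bs′
      γ-body = trans (substG-∘ γ (ren ρ) bs)
                     (trans (sym (substG-cong bs (λ a _ → s-clause a))) (sym (substG-∘ s (ren (N +_)) bs)))

  F-resolves : F Φ ⊢ ⌈ T₁ ⌉ ↝* [] → F Φ ⊢ ⌈ T ⌉ ↝* []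
  F-resolves derivation =
    subst (λ g → F Φ ⊢ g ↝* []) (sym tagGoal-T)
      (step ⌈ TL ⌉ (tagAtom (X , z)) ⌈ TR ⌉ (Fclause c) (∈-map⁺ Fclause c∈Φ) (N +_) (+-cancelˡ-≡ N _ _)
            (λ v v∈C v∈G → apart (v∈C , subst (λ g → v ∈ varsG g) (sym tagGoal-T) v∈G))
            (proj₁ F-mgu) (proj₂ F-mgu)
       ◅ subst (λ g → F Φ ⊢ g ↝* []) tagGoal-T₁-split derivation)

module _ {Fn Pr K : Set} (Φ : Program Fn Pr K) where

  complete : {G : Goal Fn Pr} → Φ ⊢ G ↝* [] → (T : Tagged Fn Pr) (σ : Subst Fn) →
             WellTagged T → G ≡ substG σ (atoms T) → F Φ ⊢ tagGoal {K = K} T ↝* []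
  complete ε [] σ well G≡ = ε
  complete (step L A R (clause κ bs C) c∈Φ ρ _ _ γ γ-mgu ◅ rest) T σ well G≡
    with map-split (λ p → substA σ (proj₁ p)) T L A R (trans (map-∘ T) (sym G≡))
  ... | TL , (X , z) , TR , refl , refl , refl , refl =
    F-resolves (complete rest T₁ δ₀ well-T₁ resolvent)
    where open CompletenessStep Φ TL TR X z σ κ bs C c∈Φ ρ γ γ-mgu well

  sound : {G : Goal (Fn ⊎ K) Pr} → F Φ ⊢ G ↝* [] → (T : Tagged Fn Pr) → WellTagged T →
          G ≡ tagGoal {K = K} T → (π : Renaming) →
          Φ ⊢ substG (ren (Renaming.rename π)) (atoms T) ↝* []
  sound ε [] well G≡ π = ε
  sound (step L A R c′ c′∈FΦ ρ ρ-inj apart μ mgu ◅ rest) T well G≡ π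
    with map-split tagAtom T L A R (sym G≡) | ∈-map⁻ Fclause c′∈FΦ
  ... | TL , (X , z) , TR , refl , refl , refl , refl | clause κ bs C , c∈Φ , refl =
    resolve well apart′ μ mgu π (sound rest T₁ well-T₁ (sym tagGoal-T₁-split) doubling)
    where
      open SoundnessStep Φ TL TR X z κ bs C c∈Φ ρ ρ-inj
      apart′ : Disjoint varsC′ (varsG ⌈ TL ++ (X , z) ∷ TR ⌉)
      apart′ (v∈C , v∈T) = apart _ v∈C (subst (λ g → _ ∈ varsG g) tagGoal-T v∈T)
      open Apart well apart′ using (module WithMGU)
      open WithMGU μ mgu using (T₁; well-T₁; tagGoal-T₁-split)

theorem6 : {Fn Pr K : Set} (Φ : Program Fn Pr K) → Unique (map label Φ) →
    (A : Atom Fn Pr) (y : ℕ) → y ∉ varsA A →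
    (Φ ⊢ (A ∷ []) ↝* []) ⇔ (F Φ ⊢ (embA {K = K} A [ var y ] ∷ []) ↝* [])
theorem6 Φ _ A y y∉A = mk⇔
  (λ derivation → complete Φ derivation ((A , y) ∷ []) var well (cong (_∷ []) (sym (substA-var A))))
  (λ derivation → subst (λ G → Φ ⊢ G ↝* []) (cong (_∷ []) (substA-var A))
                        (sound Φ derivation ((A , y) ∷ []) well refl identity))
  where
    well : WellTagged ((A , y) ∷ [])
    well = ([] ∷ []) , λ where
      (here refl , y∈) → y∉A (subst (y ∈_) (++-identityʳ (varsA A)) y∈)
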